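{- Let $n$, $t$, $s$ be positive integers with $n\geq t+s+2$, and let $\mathcal{F}\subseteq\binom{[n]}{t+1}$ be an $s$-almost $t$-intersecting family which is not $t$-intersecting and which has maximum size among all such families. Let $A,B\in\mathcal{F}$ with $A\setminus B=\{1,2\}$ and $B\setminus A=\{3,4\}$. Then: (i) $\mathcal{F}\setminus \mathcal{E}= \mathcal{D}\cup\left(\bigcup_{i\in[4]} \mathcal{F}\cap \mathcal{G}_{i}\right)$; (ii) if $D\in \mathcal{D}$, then $D=(A\cap B)\cup\{y,y'\}$ for some distinct $y,y'\notin A\cup B$, or $D=(A\cup B)\setminus\{z,z'\}$ for some distinct $z,z'\in A\cap B$; (iii) for each $i\in[4]$, either $\mathcal{F}\cap\{X_{i,x}\in\mathcal{G}_{i}:x\notin A\cup B\}=\emptyset$ or $\mathcal{F}\cap \{X_{i,x}\in\mathcal{G}_{i}:x\in A\cap B\}=\emptyset$.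
   Context: $\mathcal{F}$ is $s$-almost $t$-intersecting if $\left|\{F'\in\mathcal{F}: |F'\cap F|<t\}\right|\leq s$ for every $F\in\mathcal{F}$; $t$-intersecting if any two members share at least $t$ elements. For a family $\mathcal{G}$ and $H\subseteq[n]$, $\mathcal{D}_{\mathcal{G}}(H;t)=\{G\in\mathcal{G}: |G\cap H|<t\}$. Here $|A|=|B|=t+1$, $|A\cap B|=t-1$. For $i\in[4]$ and $x\in[n]\setminus\{i\}$ put $X_{i,x}=(A\cap B)\cup\{i,x\}$ if $x\notin A\cap B$, and $X_{i,x}=(A\cup B)\setminus\{i,x\}$ if $x\in A\cap B$. Set $\mathcal{D}=\mathcal{D}_{\mathcal{F}}(A;t)\cap\mathcal{D}_{\mathcal{F}}(B;t)$, $\mathcal{E}=\{X_{i,x}:\{i,x\}\in\binom{[4]}{2}\}$, and $\mathcal{G}_i=\{X_{i,x}: x\in[n]\setminus[4]\}$ for $i\in[4]$. -}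

module Defs where

open import Data.Nat using (ℕ; zero; suc; _+_; _≤_; _<_; _<?_)
open import Data.Bool using (Bool; true; false; if_then_else_; _∧_)
open import Data.List using (List; []; _∷_; map; _++_)
open import Data.Fin using (Fin; toℕ)
open import Data.Fin.Subset using (Subset; _∩_; _∪_; _─_; ⁅_⁆; ∣_∣; _∈_; _∉_; inside; outside)
open import Data.Fin.Subset.Properties using (_∈?_)
open import Data.Vec using (_∷_; [])
open import Data.Product using (Σ; _×_; ∃)
open import Data.Sum using (_⊎_)
open import Relation.Nullary using (¬_; does)
open import Relation.Binary.PropositionalEquality using (_≡_; _≢_)

-- Ground set [n] = {1,…,n} is modelled by Fin n, element k ∈ [n] ↔ Fin index k-1.
-- So the elements 1,2,3,4 of the paper are the Fin-elements with toℕ = 0,1,2,3,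
-- and "x ∈ [4]" is "toℕ x < 4".

Family : ℕ → Set
Family n = Subset n → Bool

_∈F_ : ∀ {n} → Subset n → Family n → Set
S ∈F 𝓕 = 𝓕 S ≡ true

allSubsets : (n : ℕ) → List (Subset n)
allSubsets zero = [] ∷ []
allSubsets (suc n) = map (inside ∷_) (allSubsets n) ++ map (outside ∷_) (allSubsets n)

countTrue : ∀ {n} → Family n → List (Subset n) → ℕ
countTrue 𝓕 [] = 0
countTrue 𝓕 (S ∷ Ss) = (if 𝓕 S then 1 else 0) + countTrue 𝓕 Ss

size : ∀ {n} → Family n → ℕ
size {n} 𝓕 = countTrue 𝓕 (allSubsets n)

Uniform : ∀ {n} → ℕ → Family n → Set
Uniform k 𝓕 = ∀ S → S ∈F 𝓕 → ∣ S ∣ ≡ k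

Dfam : ∀ {n} → Family n → Subset n → ℕ → Family n
Dfam 𝓖 H t G = 𝓖 G ∧ does (∣ G ∩ H ∣ <? t)

AlmostIntersecting : ∀ {n} → ℕ → ℕ → Family n → Set
AlmostIntersecting s t 𝓕 = ∀ F → F ∈F 𝓕 → size (Dfam 𝓕 F t) ≤ s

Intersecting : ∀ {n} → ℕ → Family n → Set
Intersecting t 𝓕 = ∀ F G → F ∈F 𝓕 → G ∈F 𝓕 → t ≤ ∣ F ∩ G ∣

Admissible : ∀ {n} → ℕ → ℕ → Family n → Set
Admissible s t 𝓕 = Uniform (suc t) 𝓕 × AlmostIntersecting s t 𝓕 × ¬ Intersecting t 𝓕

X : ∀ {n} → Subset n → Subset n → Fin n → Fin n → Subset n
X A B i x = if does (x ∈? (A ∩ B))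
            then (A ∪ B) ─ (⁅ i ⁆ ∪ ⁅ x ⁆)
            else (A ∩ B) ∪ (⁅ i ⁆ ∪ ⁅ x ⁆)

InE : ∀ {n} → Subset n → Subset n → Subset n → Set
InE A B S = Σ (Fin _) λ i → Σ (Fin _) λ x →
  toℕ i < 4 × toℕ x < 4 × i ≢ x × S ≡ X A B i x

InG : ∀ {n} → Subset n → Subset n → Fin n → Subset n → Set
InG A B i S = Σ (Fin _) λ x → 4 ≤ toℕ x × S ≡ X A B i x

InD : ∀ {n} → Family n → ℕ → Subset n → Subset n → Subset n → Set
InD 𝓕 t A B S = S ∈F Dfam 𝓕 A t × S ∈F Dfam 𝓕 B t

-- Write t = u + 1, so members have u + 2 points and C = A ∩ B has u.
--
-- For s + 1 points Y outside A, the family {A} ∪ {C ∪ {i, y} : i ∈ A ∖ B, y ∈ Y} is admissible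
-- and has 2s + 3 members, so |𝓕| ≥ 2s + 3 by maximality. Consequently any two members of 𝓕 share
-- at least u points: otherwise every member would be far from one of them, and |𝓕| ≤ 2s.
-- A member S thus has |S ∩ A|, |S ∩ B| ≥ u, and counting how S meets C, A ∖ B, B ∖ A and the
-- outside of A ∪ B leaves only the shapes listed in (i) and (ii), plus one shape for members D of 𝒟:
-- D misses a point of C, a point i ∈ A ∖ B and a point j ∈ B ∖ A. That shape is impossible:
-- C ∪ {i, j} would meet D in fewer than u points, yet it must lie in 𝓕 lest |𝓕| ≤ 2s + 2.
-- For (iii), X_{i,y} with y ∉ A ∪ B and X_{i,x} with x ∈ C share only points of C ∖ {x}.

module Submission where

open import Data.Bool using (Bool; true; false; _∧_; _∨_; if_then_else_)
import Data.Bool as Bool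
open import Data.Bool.Properties using (∨-zeroʳ; ∧-conicalˡ; ∧-conicalʳ)
open import Data.Empty using (⊥)
open import Data.Fin using (Fin; toℕ; fromℕ<)
open import Data.Fin.Properties as Fin using (toℕ-fromℕ<; toℕ-injective)
open import Data.Fin.Subset
  using (Subset; _∩_; _∪_; _─_; _-_; ⁅_⁆; ∁; ∣_∣; _∈_; _∉_; _⊆_; Nonempty; inside; outside)
open import Data.Fin.Subset.Properties
open import Data.List using (List; []; _∷_; length; map; _++_)
open import Data.List.Properties using (map-++; map-∘; length-map; length-++)
open import Data.List.Membership.Propositional using () renaming (_∈_ to _∈ₗ_; _∉_ to _∉ₗ_)
open import Data.List.Membership.Propositional.Properties using (∈-map⁻; ∈-map⁺; ∈-++⁻; ∈-++⁺ˡ; ∈-++⁺ʳ)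
open import Data.List.Relation.Unary.All as All using (All; []; _∷_)
import Data.List.Relation.Unary.All.Properties as All
open import Data.List.Relation.Unary.AllPairs using ([]; _∷_)
open import Data.List.Relation.Unary.Any using (here; there; any?)
open import Data.List.Relation.Unary.Unique.Propositional using (Unique)
open import Data.List.Relation.Unary.Unique.Propositional.Properties using (Unique[x∷xs]⇒x∉xs; ++⁺)
open import Data.Nat using (ℕ; zero; suc; _+_; _∸_; _≤_; _<_; z≤n; s≤s; z<s; s<s; _≤?_; _<?_)
open import Data.Nat.ListAction using (sum)
open import Data.Nat.ListAction.Properties using (sum-++)
open import Data.Nat.Properties
open import Algebra.Properties.CommutativeSemigroup +-commutativeSemigroup using ()
  renaming (interchange to +-interchange)
open import Data.Nat.Tactic.RingSolver using (solve-∀)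
open import Data.Product using (Σ; ∃; ∃₂; _×_; _,_; proj₁; proj₂)
open import Data.Sum as Sum using (_⊎_; inj₁; inj₂; [_,_]′)
open import Data.Sum.Function.Propositional using (_⊎-⇔_)
open import Data.Vec using (_∷_; []; here; there)
open import Data.Vec.Properties using (≡-dec)
open import Function using (_∘_)
open import Function.Bundles using (_⇔_; Equivalence; mk⇔)
import Function.Properties.Equivalence as ⇔
open import Relation.Binary.Definitions using (DecidableEquality)
open import Relation.Binary.PropositionalEquality
open import Relation.Nullary using (¬_; Dec; yes; no; does; contradiction)
open import Relation.Nullary.Decidable using (dec-true; dec-false; ¬?; _×-dec_)

open import Defs

private variable
  n : ℕ

∣p∣≡∣p∩q∣+∣p─q∣ : (p q : Subset n) → ∣ p ∣ ≡ ∣ p ∩ q ∣ + ∣ p ─ q ∣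
∣p∣≡∣p∩q∣+∣p─q∣ [] [] = refl
∣p∣≡∣p∩q∣+∣p─q∣ (inside ∷ p) (inside ∷ q) = cong suc (∣p∣≡∣p∩q∣+∣p─q∣ p q)
∣p∣≡∣p∩q∣+∣p─q∣ (inside ∷ p) (outside ∷ q) = trans (cong suc (∣p∣≡∣p∩q∣+∣p─q∣ p q)) (sym (+-suc _ _))
∣p∣≡∣p∩q∣+∣p─q∣ (outside ∷ p) (inside ∷ q) = ∣p∣≡∣p∩q∣+∣p─q∣ p q
∣p∣≡∣p∩q∣+∣p─q∣ (outside ∷ p) (outside ∷ q) = ∣p∣≡∣p∩q∣+∣p─q∣ p q

∣p∩q∣+∣p∪q∣≡∣p∣+∣q∣ : (p q : Subset n) → ∣ p ∩ q ∣ + ∣ p ∪ q ∣ ≡ ∣ p ∣ + ∣ q ∣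
∣p∩q∣+∣p∪q∣≡∣p∣+∣q∣ [] [] = refl
∣p∩q∣+∣p∪q∣≡∣p∣+∣q∣ (inside ∷ p) (inside ∷ q) =
  cong suc (trans (+-suc _ _) (trans (cong suc (∣p∩q∣+∣p∪q∣≡∣p∣+∣q∣ p q)) (sym (+-suc _ _))))
∣p∩q∣+∣p∪q∣≡∣p∣+∣q∣ (inside ∷ p) (outside ∷ q) = trans (+-suc _ _) (cong suc (∣p∩q∣+∣p∪q∣≡∣p∣+∣q∣ p q))
∣p∩q∣+∣p∪q∣≡∣p∣+∣q∣ (outside ∷ p) (inside ∷ q) =
  trans (+-suc _ _) (trans (cong suc (∣p∩q∣+∣p∪q∣≡∣p∣+∣q∣ p q)) (sym (+-suc _ _)))
∣p∩q∣+∣p∪q∣≡∣p∣+∣q∣ (outside ∷ p) (outside ∷ q) = ∣p∩q∣+∣p∪q∣≡∣p∣+∣q∣ p q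

∣r∩p∣+∣r∩q∣≡∣r∩p∩q∣+∣r∩[p∪q]∣ : (r p q : Subset n) → ∣ r ∩ p ∣ + ∣ r ∩ q ∣ ≡ ∣ r ∩ p ∩ q ∣ + ∣ r ∩ (p ∪ q) ∣
∣r∩p∣+∣r∩q∣≡∣r∩p∩q∣+∣r∩[p∪q]∣ [] [] [] = refl
∣r∩p∣+∣r∩q∣≡∣r∩p∩q∣+∣r∩[p∪q]∣ (outside ∷ r) (_ ∷ p) (_ ∷ q) = ∣r∩p∣+∣r∩q∣≡∣r∩p∩q∣+∣r∩[p∪q]∣ r p q
∣r∩p∣+∣r∩q∣≡∣r∩p∩q∣+∣r∩[p∪q]∣ (inside ∷ r) (inside ∷ p) (inside ∷ q) =
  cong suc (trans (+-suc _ _) (trans (cong suc (∣r∩p∣+∣r∩q∣≡∣r∩p∩q∣+∣r∩[p∪q]∣ r p q)) (sym (+-suc _ _))))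
∣r∩p∣+∣r∩q∣≡∣r∩p∩q∣+∣r∩[p∪q]∣ (inside ∷ r) (inside ∷ p) (outside ∷ q) =
  trans (cong suc (∣r∩p∣+∣r∩q∣≡∣r∩p∩q∣+∣r∩[p∪q]∣ r p q)) (sym (+-suc _ _))
∣r∩p∣+∣r∩q∣≡∣r∩p∩q∣+∣r∩[p∪q]∣ (inside ∷ r) (outside ∷ p) (inside ∷ q) =
  trans (+-suc _ _) (trans (cong suc (∣r∩p∣+∣r∩q∣≡∣r∩p∩q∣+∣r∩[p∪q]∣ r p q)) (sym (+-suc _ _)))
∣r∩p∣+∣r∩q∣≡∣r∩p∩q∣+∣r∩[p∪q]∣ (inside ∷ r) (outside ∷ p) (outside ∷ q) = ∣r∩p∣+∣r∩q∣≡∣r∩p∩q∣+∣r∩[p∪q]∣ r p q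

x∈p─q⁻ : ∀ {x : Fin n} (p q : Subset n) → x ∈ p ─ q → x ∈ p × x ∉ q
x∈p─q⁻ (inside ∷ p) (outside ∷ q) here = here , λ ()
x∈p─q⁻ (_ ∷ p) (inside ∷ q) (there x∈) = let (x∈p , x∉q) = x∈p─q⁻ p q x∈ in there x∈p , λ { (there x∈q) → x∉q x∈q }
x∈p─q⁻ (_ ∷ p) (outside ∷ q) (there x∈) = let (x∈p , x∉q) = x∈p─q⁻ p q x∈ in there x∈p , λ { (there x∈q) → x∉q x∈q }

x∈⁅y⁆∪⁅z⁆⁻ : ∀ {x y z : Fin n} → x ∈ ⁅ y ⁆ ∪ ⁅ z ⁆ → x ≡ y ⊎ x ≡ z
x∈⁅y⁆∪⁅z⁆⁻ {y = y} {z} x∈ = Sum.map (x∈⁅y⁆⇒x≡y y) (x∈⁅y⁆⇒x≡y z) (x∈p∪q⁻ ⁅ y ⁆ ⁅ z ⁆ x∈)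

x∈⁅y⁆∪⁅z⁆⁺ : ∀ {x y z : Fin n} → x ≡ y ⊎ x ≡ z → x ∈ ⁅ y ⁆ ∪ ⁅ z ⁆
x∈⁅y⁆∪⁅z⁆⁺ (inj₁ refl) = x∈p∪q⁺ (inj₁ (x∈⁅x⁆ _))
x∈⁅y⁆∪⁅z⁆⁺ (inj₂ refl) = x∈p∪q⁺ (inj₂ (x∈⁅x⁆ _))

p⊆q∧∣q∣≤∣p∣⇒p≡q : {p q : Subset n} → p ⊆ q → ∣ q ∣ ≤ ∣ p ∣ → p ≡ q
p⊆q∧∣q∣≤∣p∣⇒p≡q {p = p} p⊆q ∣q∣≤∣p∣ = ⊆-antisym p⊆q q⊆p
  where
  q⊆p : _ ⊆ p
  q⊆p {x} x∈q with x ∈? p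
  ... | yes x∈p = x∈p
  ... | no x∉p = contradiction (p⊂q⇒∣p∣<∣q∣ (p⊆q , x , x∈q , x∉p)) (≤⇒≯ ∣q∣≤∣p∣)

∣p∣≤∣p∩q∣⇒p⊆q : (p q : Subset n) → ∣ p ∣ ≤ ∣ p ∩ q ∣ → p ⊆ q
∣p∣≤∣p∩q∣⇒p⊆q p q ∣p∣≤ x∈p =
  proj₂ (x∈p∩q⁻ p q (subst (_ ∈_) (sym (p⊆q∧∣q∣≤∣p∣⇒p≡q (p∩q⊆p p q) ∣p∣≤)) x∈p))

∣q∣≤∣p∩q∣⇒q⊆p : (p q : Subset n) → ∣ q ∣ ≤ ∣ p ∩ q ∣ → q ⊆ p
∣q∣≤∣p∩q∣⇒q⊆p p q ∣q∣≤ x∈q =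
  proj₁ (x∈p∩q⁻ p q (subst (_ ∈_) (sym (p⊆q∧∣q∣≤∣p∣⇒p≡q (p∩q⊆q p q) ∣q∣≤)) x∈q))

0<∣p∣⇒Nonempty : (p : Subset n) → 0 < ∣ p ∣ → Nonempty p
0<∣p∣⇒Nonempty {n} p 0<∣p∣ with nonempty? p
... | yes ne = ne
... | no empty = contradiction (trans (cong ∣_∣ (Empty-unique empty)) (∣⊥∣≡0 n)) (>⇒≢ 0<∣p∣)

x∉p⇒∣p∪⁅x⁆∣≡1+∣p∣ : (p : Subset n) {x : Fin n} → x ∉ p → ∣ p ∪ ⁅ x ⁆ ∣ ≡ suc ∣ p ∣
x∉p⇒∣p∪⁅x⁆∣≡1+∣p∣ {n} p {x} x∉p = begin
  ∣ p ∪ ⁅ x ⁆ ∣                   ≡⟨ cong (_+ ∣ p ∪ ⁅ x ⁆ ∣) ∣p∩⁅x⁆∣≡0 ⟨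
  ∣ p ∩ ⁅ x ⁆ ∣ + ∣ p ∪ ⁅ x ⁆ ∣   ≡⟨ ∣p∩q∣+∣p∪q∣≡∣p∣+∣q∣ p ⁅ x ⁆ ⟩
  ∣ p ∣ + ∣ ⁅ x ⁆ ∣               ≡⟨ cong (∣ p ∣ +_) (∣⁅x⁆∣≡1 x) ⟩
  ∣ p ∣ + 1                       ≡⟨ +-comm ∣ p ∣ 1 ⟩
  suc ∣ p ∣                       ∎
  where
  open ≡-Reasoning
  ∣p∩⁅x⁆∣≡0 : ∣ p ∩ ⁅ x ⁆ ∣ ≡ 0
  ∣p∩⁅x⁆∣≡0 = trans (cong ∣_∣ (Empty-unique λ (y , y∈) → let (y∈p , y∈⁅x⁆) = x∈p∩q⁻ p ⁅ x ⁆ y∈ in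
                                   x∉p (subst (_∈ p) (x∈⁅y⁆⇒x≡y x y∈⁅x⁆) y∈p)))
                    (∣⊥∣≡0 n)

∣p∪⁅x⁆∪⁅y⁆∣≡2+∣p∣ : (p : Subset n) {x y : Fin n} → x ∉ p → y ∉ p → x ≢ y → ∣ p ∪ (⁅ x ⁆ ∪ ⁅ y ⁆) ∣ ≡ 2 + ∣ p ∣
∣p∪⁅x⁆∪⁅y⁆∣≡2+∣p∣ p {x} {y} x∉p y∉p x≢y = begin
  ∣ p ∪ (⁅ x ⁆ ∪ ⁅ y ⁆) ∣ ≡⟨ cong ∣_∣ (∪-assoc p ⁅ x ⁆ ⁅ y ⁆) ⟨
  ∣ (p ∪ ⁅ x ⁆) ∪ ⁅ y ⁆ ∣ ≡⟨ x∉p⇒∣p∪⁅x⁆∣≡1+∣p∣ (p ∪ ⁅ x ⁆) y∉p∪⁅x⁆ ⟩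
  suc ∣ p ∪ ⁅ x ⁆ ∣       ≡⟨ cong suc (x∉p⇒∣p∪⁅x⁆∣≡1+∣p∣ p x∉p) ⟩
  2 + ∣ p ∣               ∎
  where
  open ≡-Reasoning
  y∉p∪⁅x⁆ : y ∉ p ∪ ⁅ x ⁆
  y∉p∪⁅x⁆ y∈ with x∈p∪q⁻ p ⁅ x ⁆ y∈
  ... | inj₁ y∈p = y∉p y∈p
  ... | inj₂ y∈⁅x⁆ = x≢y (sym (x∈⁅y⁆⇒x≡y x y∈⁅x⁆))

∣⁅x⁆∪⁅y⁆∣≡2 : {x y : Fin n} → x ≢ y → ∣ ⁅ x ⁆ ∪ ⁅ y ⁆ ∣ ≡ 2
∣⁅x⁆∪⁅y⁆∣≡2 {x = x} x≢y =
  trans (x∉p⇒∣p∪⁅x⁆∣≡1+∣p∣ ⁅ x ⁆ λ y∈⁅x⁆ → x≢y (sym (x∈⁅y⁆⇒x≡y x y∈⁅x⁆))) (cong suc (∣⁅x⁆∣≡1 x))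

p≡r∪⁅a⁆∪⁅b⁆ : {p r : Subset n} {a b : Fin n} → r ⊆ p → a ∈ p → b ∈ p → a ∉ r → b ∉ r → a ≢ b →
              ∣ p ∣ ≤ 2 + ∣ r ∣ → p ≡ r ∪ (⁅ a ⁆ ∪ ⁅ b ⁆)
p≡r∪⁅a⁆∪⁅b⁆ {p = p} {r} {a} {b} r⊆p a∈p b∈p a∉r b∉r a≢b ∣p∣≤ =
  sym (p⊆q∧∣q∣≤∣p∣⇒p≡q r∪⁅a⁆∪⁅b⁆⊆p (≤-trans ∣p∣≤ (≤-reflexive (sym (∣p∪⁅x⁆∪⁅y⁆∣≡2+∣p∣ r a∉r b∉r a≢b)))))
  where
  r∪⁅a⁆∪⁅b⁆⊆p : r ∪ (⁅ a ⁆ ∪ ⁅ b ⁆) ⊆ p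
  r∪⁅a⁆∪⁅b⁆⊆p x∈ with x∈p∪q⁻ r _ x∈
  ... | inj₁ x∈r = r⊆p x∈r
  ... | inj₂ x∈ab with x∈⁅y⁆∪⁅z⁆⁻ x∈ab
  ...   | inj₁ refl = a∈p
  ...   | inj₂ refl = b∈p

p≡q─⁅a⁆∪⁅b⁆ : {p q : Subset n} {a b : Fin n} → p ⊆ q → a ∈ q → b ∈ q → a ∉ p → b ∉ p → a ≢ b →
              ∣ q ∣ ≤ 2 + ∣ p ∣ → p ≡ q ─ (⁅ a ⁆ ∪ ⁅ b ⁆)
p≡q─⁅a⁆∪⁅b⁆ {p = p} {q} {a} {b} p⊆q a∈q b∈q a∉p b∉p a≢b ∣q∣≤ =
  p⊆q∧∣q∣≤∣p∣⇒p≡q p⊆q─ab (+-cancelˡ-≤ 2 _ _ (begin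
    2 + ∣ q ─ ab ∣         ≡⟨ cong (_+ ∣ q ─ ab ∣) (∣⁅x⁆∪⁅y⁆∣≡2 a≢b) ⟨
    ∣ ab ∣ + ∣ q ─ ab ∣    ≤⟨ +-monoˡ-≤ _ (p⊆q⇒∣p∣≤∣q∣ ab⊆q∩ab) ⟩
    ∣ q ∩ ab ∣ + ∣ q ─ ab ∣ ≡⟨ ∣p∣≡∣p∩q∣+∣p─q∣ q ab ⟨
    ∣ q ∣                  ≤⟨ ∣q∣≤ ⟩
    2 + ∣ p ∣              ∎))
  where
  open ≤-Reasoning
  ab = ⁅ a ⁆ ∪ ⁅ b ⁆
  p⊆q─ab : p ⊆ q ─ ab
  p⊆q─ab x∈p = x∈p∧x∉q⇒x∈p─q (p⊆q x∈p) λ x∈ab → [ (λ { refl → a∉p x∈p }) , (λ { refl → b∉p x∈p }) ]′ (x∈⁅y⁆∪⁅z⁆⁻ x∈ab)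
  ab⊆q∩ab : ab ⊆ q ∩ ab
  ab⊆q∩ab x∈ab = x∈p∩q⁺ ([ (λ { refl → a∈q }) , (λ { refl → b∈q }) ]′ (x∈⁅y⁆∪⁅z⁆⁻ x∈ab) , x∈ab)

1+∣r∣≤∣p∩q∣ : {r p q : Subset n} {k : Fin n} → r ⊆ p → r ⊆ q → k ∈ p → k ∈ q → k ∉ r → suc ∣ r ∣ ≤ ∣ p ∩ q ∣
1+∣r∣≤∣p∩q∣ r⊆p r⊆q k∈p k∈q k∉r = p⊂q⇒∣p∣<∣q∣ ((λ x∈r → x∈p∩q⁺ (r⊆p x∈r , r⊆q x∈r)) , _ , x∈p∩q⁺ (k∈p , k∈q) , k∉r)

2+∣p∩r∣≤∣p∩q∣ : {p q r : Subset n} {a b : Fin n} → r ⊆ q → a ≢ b → a ∈ p → b ∈ p → a ∈ q → b ∈ q →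
                a ∉ r → b ∉ r → 2 + ∣ p ∩ r ∣ ≤ ∣ p ∩ q ∣
2+∣p∩r∣≤∣p∩q∣ {p = p} {q} {r} {a} {b} r⊆q a≢b a∈p b∈p a∈q b∈q a∉r b∉r =
  subst (_≤ ∣ p ∩ q ∣) (∣p∪⁅x⁆∪⁅y⁆∣≡2+∣p∣ (p ∩ r) (a∉r ∘ ∈r) (b∉r ∘ ∈r) a≢b) (p⊆q⇒∣p∣≤∣q∣ sub)
  where
  ∈r : ∀ {x} → x ∈ p ∩ r → x ∈ r
  ∈r x∈ = proj₂ (x∈p∩q⁻ p r x∈)
  sub : (p ∩ r) ∪ (⁅ a ⁆ ∪ ⁅ b ⁆) ⊆ p ∩ q
  sub x∈ with x∈p∪q⁻ (p ∩ r) _ x∈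
  ... | inj₁ x∈p∩r = let (x∈p , x∈r) = x∈p∩q⁻ p r x∈p∩r in x∈p∩q⁺ (x∈p , r⊆q x∈r)
  ... | inj₂ x∈ab with x∈⁅y⁆∪⁅z⁆⁻ x∈ab
  ...   | inj₁ refl = x∈p∩q⁺ (a∈p , a∈q)
  ...   | inj₂ refl = x∈p∩q⁺ (b∈p , b∈q)

∣p∩r∣<∣p∩q∣⇒Nonempty : (p q r : Subset n) → ∣ p ∩ r ∣ < ∣ p ∩ q ∣ → Nonempty (p ∩ q ─ r)
∣p∩r∣<∣p∩q∣⇒Nonempty p q r ∣p∩r∣< = 0<∣p∣⇒Nonempty (p ∩ q ─ r) (+-cancelˡ-< ∣ p ∩ r ∣ 0 _ (begin-strict
  ∣ p ∩ r ∣ + 0                    ≡⟨ +-identityʳ _ ⟩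
  ∣ p ∩ r ∣                        <⟨ ∣p∩r∣< ⟩
  ∣ p ∩ q ∣                        ≡⟨ ∣p∣≡∣p∩q∣+∣p─q∣ (p ∩ q) r ⟩
  ∣ (p ∩ q) ∩ r ∣ + ∣ p ∩ q ─ r ∣ ≤⟨ +-monoˡ-≤ _ (p⊆q⇒∣p∣≤∣q∣ p∩q∩r⊆p∩r) ⟩
  ∣ p ∩ r ∣ + ∣ p ∩ q ─ r ∣       ∎))
  where
  open ≤-Reasoning
  p∩q∩r⊆p∩r : (p ∩ q) ∩ r ⊆ p ∩ r
  p∩q∩r⊆p∩r x∈ = let (x∈p∩q , x∈r) = x∈p∩q⁻ (p ∩ q) r x∈ in x∈p∩q⁺ (proj₁ (x∈p∩q⁻ p q x∈p∩q) , x∈r)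

∣p∣≤1+∣p-x∣ : (p : Subset n) (x : Fin n) → ∣ p ∣ ≤ suc ∣ p - x ∣
∣p∣≤1+∣p-x∣ p x = begin
  ∣ p ∣                        ≡⟨ ∣p∣≡∣p∩q∣+∣p─q∣ p ⁅ x ⁆ ⟩
  ∣ p ∩ ⁅ x ⁆ ∣ + ∣ p - x ∣   ≤⟨ +-monoˡ-≤ _ (≤-trans (∣p∩q∣≤∣q∣ p ⁅ x ⁆) (≤-reflexive (∣⁅x⁆∣≡1 x))) ⟩
  suc ∣ p - x ∣                ∎
  where open ≤-Reasoning

distinct-elements : ∀ m (p : Subset n) → m ≤ ∣ p ∣ →
                    Σ (List (Fin n)) λ xs → length xs ≡ m × Unique xs × All (_∈ p) xs
distinct-elements zero p _ = [] , refl , [] , []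
distinct-elements (suc m) p m<∣p∣ =
  let (x , x∈p) = 0<∣p∣⇒Nonempty p (m<n⇒0<n m<∣p∣)
      (xs , len , unique , xs⊆p-x) = distinct-elements m (p - x) (≤-pred (≤-trans m<∣p∣ (∣p∣≤1+∣p-x∣ p x)))
  in x ∷ xs , cong suc len ,
     All.map (λ y∈p-x x≡y → proj₂ (x∈p─q⁻ p ⁅ x ⁆ y∈p-x) (subst (_∈ ⁅ x ⁆) x≡y (x∈⁅x⁆ x))) xs⊆p-x ∷ unique ,
     x∈p ∷ All.map (p─q⊆p p ⁅ x ⁆) xs⊆p-x

2≤∣p∣⇒distinct-pair : (p : Subset n) → 2 ≤ ∣ p ∣ → ∃₂ λ x y → x ≢ y × x ∈ p × y ∈ p
2≤∣p∣⇒distinct-pair p 2≤∣p∣ with distinct-elements 2 p 2≤∣p∣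
... | x ∷ y ∷ [] , _ , (x≢y ∷ []) ∷ _ , x∈p ∷ y∈p ∷ [] = x , y , x≢y , x∈p , y∈p

p⊆q⇒∣p∩q∣≡∣p∣ : {p q : Subset n} → p ⊆ q → ∣ p ∩ q ∣ ≡ ∣ p ∣
p⊆q⇒∣p∩q∣≡∣p∣ {p = p} {q} p⊆q = ≤-antisym (∣p∩q∣≤∣p∣ p q) (p⊆q⇒∣p∣≤∣q∣ λ x∈p → x∈p∩q⁺ (x∈p , p⊆q x∈p))

q⊆p⇒∣p∩q∣≡∣q∣ : {p q : Subset n} → q ⊆ p → ∣ p ∩ q ∣ ≡ ∣ q ∣
q⊆p⇒∣p∩q∣≡∣q∣ {p = p} {q} q⊆p = ≤-antisym (∣p∩q∣≤∣q∣ p q) (p⊆q⇒∣p∣≤∣q∣ λ x∈q → x∈p∩q⁺ (q⊆p x∈q , x∈q))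

both-or-missing : (p : Subset n) (a b : Fin n) → (a ∈ p × b ∈ p) ⊎ ∃ λ i → (i ≡ a ⊎ i ≡ b) × i ∉ p
both-or-missing p a b with a ∈? p | b ∈? p
... | yes a∈p | yes b∈p = inj₁ (a∈p , b∈p)
... | no a∉p | _ = inj₂ (a , inj₁ refl , a∉p)
... | yes _ | no b∉p = inj₂ (b , inj₂ refl , b∉p)

-- Counting the members of a family

𝟙 : Bool → ℕ
𝟙 b = if b then 1 else 0

𝟙-mono : {a b : Bool} → (a ≡ true → b ≡ true) → 𝟙 a ≤ 𝟙 b
𝟙-mono {false} _ = z≤n
𝟙-mono {true} a⇒b rewrite a⇒b refl = ≤-refl

𝟙-∨≤ : (a b : Bool) → 𝟙 (a ∨ b) ≤ 𝟙 a + 𝟙 b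
𝟙-∨≤ true _ = s≤s z≤n
𝟙-∨≤ false _ = ≤-refl

does≡true⇒ : {P : Set} (P? : Dec P) → does P? ≡ true → P
does≡true⇒ (yes p) _ = p
does≡true⇒ (no _) ()

∧≡true : {a b : Bool} → a ≡ true → b ≡ true → a ∧ b ≡ true
∧≡true refl refl = refl

module _ {A : Set} where

  sum-map-mono : {w v : A → ℕ} (xs : List A) → (∀ x → w x ≤ v x) → sum (map w xs) ≤ sum (map v xs)
  sum-map-mono [] _ = z≤n
  sum-map-mono (x ∷ xs) w≤v = +-mono-≤ (w≤v x) (sum-map-mono xs w≤v)

  sum-map-+ : (w v : A → ℕ) (xs : List A) → sum (map (λ x → w x + v x) xs) ≡ sum (map w xs) + sum (map v xs)
  sum-map-+ w v [] = refl
  sum-map-+ w v (x ∷ xs) = trans (cong (w x + v x +_) (sum-map-+ w v xs)) (+-interchange (w x) (v x) _ _)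

  sum-map-0 : (xs : List A) → sum (map (λ _ → 0) xs) ≡ 0
  sum-map-0 [] = refl
  sum-map-0 (_ ∷ xs) = sum-map-0 xs

_≟ₛ_ : DecidableEquality (Subset n)
_≟ₛ_ = ≡-dec Bool._≟_

total : (Subset n → ℕ) → ℕ
total {n} w = sum (map w (allSubsets n))

total-mono : {w v : Subset n → ℕ} → (∀ S → w S ≤ v S) → total w ≤ total v
total-mono {n} = sum-map-mono (allSubsets n)

total-+ : (w v : Subset n → ℕ) → total (λ S → w S + v S) ≡ total w + total v
total-+ {n} w v = sum-map-+ w v (allSubsets n)

total-suc : (w : Subset (suc n) → ℕ) → total w ≡ total (w ∘ (inside ∷_)) + total (w ∘ (outside ∷_))
total-suc {n} w = begin
  sum (map w (map (inside ∷_) L ++ map (outside ∷_) L))                ≡⟨ cong sum (map-++ w (map (inside ∷_) L) _) ⟩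
  sum (map w (map (inside ∷_) L) ++ map w (map (outside ∷_) L))       ≡⟨ sum-++ (map w (map (inside ∷_) L)) _ ⟩
  sum (map w (map (inside ∷_) L)) + sum (map w (map (outside ∷_) L))  ≡⟨ cong₂ (λ xs ys → sum xs + sum ys) (map-∘ L) (map-∘ L) ⟨
  total (w ∘ (inside ∷_)) + total (w ∘ (outside ∷_))                   ∎
  where
  open ≡-Reasoning
  L = allSubsets n

total-⁅_⁆ : (X : Subset n) → total (λ S → 𝟙 (does (S ≟ₛ X))) ≡ 1
total-⁅ [] ⁆ = refl
total-⁅_⁆ {suc n} (inside ∷ X) = trans (total-suc {n} _) (cong₂ _+_ (total-⁅ X ⁆) (sum-map-0 (allSubsets n)))
total-⁅_⁆ {suc n} (outside ∷ X) = trans (total-suc {n} _) (cong₂ _+_ (sum-map-0 (allSubsets n)) (total-⁅ X ⁆))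

size≡total : (𝓕 : Family n) → size 𝓕 ≡ total (𝟙 ∘ 𝓕)
size≡total {n} 𝓕 = go (allSubsets n)
  where
  go : (Ss : List (Subset n)) → countTrue 𝓕 Ss ≡ sum (map (𝟙 ∘ 𝓕) Ss)
  go [] = refl
  go (S ∷ Ss) = cong (𝟙 (𝓕 S) +_) (go Ss)

occurrences : List (Subset n) → Subset n → ℕ
occurrences Xs S = sum (map (λ X → 𝟙 (does (S ≟ₛ X))) Xs)

total-occurrences : (Xs : List (Subset n)) → total (occurrences Xs) ≡ length Xs
total-occurrences {n} [] = sum-map-0 (allSubsets n)
total-occurrences (X ∷ Xs) =
  trans (total-+ (λ S → 𝟙 (does (S ≟ₛ X))) (occurrences Xs)) (cong₂ _+_ (total-⁅ X ⁆) (total-occurrences Xs))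

∈ₗ⇒1≤occurrences : {S : Subset n} {Xs : List (Subset n)} → S ∈ₗ Xs → 1 ≤ occurrences Xs S
∈ₗ⇒1≤occurrences {S = S} (here refl) rewrite dec-true (S ≟ₛ S) refl = s≤s z≤n
∈ₗ⇒1≤occurrences {S = S} {X ∷ _} (there S∈) = ≤-trans (∈ₗ⇒1≤occurrences S∈) (m≤n+m _ (𝟙 (does (S ≟ₛ X))))

∉ₗ⇒occurrences≡0 : {S : Subset n} {Xs : List (Subset n)} → S ∉ₗ Xs → occurrences Xs S ≡ 0
∉ₗ⇒occurrences≡0 {Xs = []} _ = refl
∉ₗ⇒occurrences≡0 {S = S} {X ∷ _} S∉ rewrite dec-false (S ≟ₛ X) (S∉ ∘ here) = ∉ₗ⇒occurrences≡0 (S∉ ∘ there)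

Unique⇒occurrences≤1 : {S : Subset n} {Xs : List (Subset n)} → Unique Xs → occurrences Xs S ≤ 1
Unique⇒occurrences≤1 {Xs = []} _ = z≤n
Unique⇒occurrences≤1 {S = S} {X ∷ _} unique@(_ ∷ unique-tail) with S ≟ₛ X
... | yes refl = ≤-reflexive (cong suc (∉ₗ⇒occurrences≡0 (Unique[x∷xs]⇒x∉xs unique)))
... | no _ = Unique⇒occurrences≤1 {S = S} unique-tail

_⊆F_ : Family n → Family n → Set
𝓕 ⊆F 𝓖 = ∀ S → S ∈F 𝓕 → S ∈F 𝓖

_∪F_ : Family n → Family n → Family n
(𝓖 ∪F 𝓗) S = 𝓖 S ∨ 𝓗 S

module _ {n : ℕ} where
  open ≤-Reasoning

  size-mono : {𝓕 𝓖 : Family n} → 𝓕 ⊆F 𝓖 → size 𝓕 ≤ size 𝓖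
  size-mono {𝓕} {𝓖} 𝓕⊆𝓖 = begin
    size 𝓕          ≡⟨ size≡total 𝓕 ⟩
    total (𝟙 ∘ 𝓕)   ≤⟨ total-mono (λ S → 𝟙-mono {𝓕 S} {𝓖 S} (𝓕⊆𝓖 S)) ⟩
    total (𝟙 ∘ 𝓖)   ≡⟨ size≡total 𝓖 ⟨
    size 𝓖          ∎

  size-∪F≤ : (𝓖 𝓗 : Family n) → size (𝓖 ∪F 𝓗) ≤ size 𝓖 + size 𝓗
  size-∪F≤ 𝓖 𝓗 = begin
    size (𝓖 ∪F 𝓗)                         ≡⟨ size≡total (𝓖 ∪F 𝓗) ⟩
    total (𝟙 ∘ (𝓖 ∪F 𝓗))                  ≤⟨ total-mono (λ S → 𝟙-∨≤ (𝓖 S) (𝓗 S)) ⟩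
    total (λ S → 𝟙 (𝓖 S) + 𝟙 (𝓗 S))       ≡⟨ total-+ (𝟙 ∘ 𝓖) (𝟙 ∘ 𝓗) ⟩
    total (𝟙 ∘ 𝓖) + total (𝟙 ∘ 𝓗)         ≡⟨ cong₂ _+_ (size≡total 𝓖) (size≡total 𝓗) ⟨
    size 𝓖 + size 𝓗                       ∎

  size-∪F-overlap : (𝓖 𝓗 : Family n) {X : Subset n} → X ∈F 𝓖 → X ∈F 𝓗 → suc (size (𝓖 ∪F 𝓗)) ≤ size 𝓖 + size 𝓗
  size-∪F-overlap 𝓖 𝓗 {X} X∈𝓖 X∈𝓗 = begin
    suc (size (𝓖 ∪F 𝓗))                                    ≡⟨ +-comm 1 _ ⟩
    size (𝓖 ∪F 𝓗) + 1                                      ≡⟨ cong₂ _+_ (size≡total (𝓖 ∪F 𝓗)) (sym total-⁅ X ⁆) ⟩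
    total (𝟙 ∘ (𝓖 ∪F 𝓗)) + total (λ S → 𝟙 (does (S ≟ₛ X)))  ≡⟨ total-+ (𝟙 ∘ (𝓖 ∪F 𝓗)) (λ S → 𝟙 (does (S ≟ₛ X))) ⟨
    total (λ S → 𝟙 ((𝓖 ∪F 𝓗) S) + 𝟙 (does (S ≟ₛ X)))        ≤⟨ total-mono pointwise ⟩
    total (λ S → 𝟙 (𝓖 S) + 𝟙 (𝓗 S))                        ≡⟨ total-+ (𝟙 ∘ 𝓖) (𝟙 ∘ 𝓗) ⟩
    total (𝟙 ∘ 𝓖) + total (𝟙 ∘ 𝓗)                          ≡⟨ cong₂ _+_ (size≡total 𝓖) (size≡total 𝓗) ⟨
    size 𝓖 + size 𝓗                                        ∎
    where
    pointwise : ∀ S → 𝟙 ((𝓖 ∪F 𝓗) S) + 𝟙 (does (S ≟ₛ X)) ≤ 𝟙 (𝓖 S) + 𝟙 (𝓗 S)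
    pointwise S with S ≟ₛ X
    ... | yes refl rewrite X∈𝓖 | X∈𝓗 = ≤-refl
    ... | no _ = ≤-trans (≤-reflexive (+-identityʳ _)) (𝟙-∨≤ (𝓖 S) (𝓗 S))

  size≤length : (𝓕 : Family n) (Xs : List (Subset n)) → (∀ S → S ∈F 𝓕 → S ∈ₗ Xs) → size 𝓕 ≤ length Xs
  size≤length 𝓕 Xs 𝓕⊆Xs = begin
    size 𝓕                  ≡⟨ size≡total 𝓕 ⟩
    total (𝟙 ∘ 𝓕)           ≤⟨ total-mono pointwise ⟩
    total (occurrences Xs)  ≡⟨ total-occurrences Xs ⟩
    length Xs               ∎
    where
    pointwise : ∀ S → 𝟙 (𝓕 S) ≤ occurrences Xs S
    pointwise S with 𝓕 S in S∈𝓕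
    ... | true = ∈ₗ⇒1≤occurrences (𝓕⊆Xs S S∈𝓕)
    ... | false = z≤n

  size<length : (𝓕 : Family n) (Xs : List (Subset n)) {X : Subset n} → (∀ S → S ∈F 𝓕 → S ∈ₗ Xs) →
                X ∈ₗ Xs → ¬ X ∈F 𝓕 → suc (size 𝓕) ≤ length Xs
  size<length 𝓕 Xs {X} 𝓕⊆Xs X∈Xs X∉𝓕 = begin
    suc (size 𝓕)                                        ≡⟨ +-comm 1 _ ⟩
    size 𝓕 + 1                                          ≡⟨ cong₂ _+_ (size≡total 𝓕) (sym total-⁅ X ⁆) ⟩
    total (𝟙 ∘ 𝓕) + total (λ S → 𝟙 (does (S ≟ₛ X)))     ≡⟨ total-+ (𝟙 ∘ 𝓕) (λ S → 𝟙 (does (S ≟ₛ X))) ⟨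
    total (λ S → 𝟙 (𝓕 S) + 𝟙 (does (S ≟ₛ X)))           ≤⟨ total-mono pointwise ⟩
    total (occurrences Xs)                              ≡⟨ total-occurrences Xs ⟩
    length Xs                                           ∎
    where
    pointwise : ∀ S → 𝟙 (𝓕 S) + 𝟙 (does (S ≟ₛ X)) ≤ occurrences Xs S
    pointwise S with 𝓕 S in S∈𝓕 | S ≟ₛ X
    ... | true | yes refl = contradiction S∈𝓕 X∉𝓕
    ... | true | no _ = ∈ₗ⇒1≤occurrences (𝓕⊆Xs S S∈𝓕)
    ... | false | yes refl = ∈ₗ⇒1≤occurrences X∈Xs
    ... | false | no _ = z≤n

  length≤size : (𝓕 : Family n) (Xs : List (Subset n)) → Unique Xs → (∀ S → S ∈ₗ Xs → S ∈F 𝓕) → length Xs ≤ size 𝓕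
  length≤size 𝓕 Xs unique Xs⊆𝓕 = begin
    length Xs               ≡⟨ total-occurrences Xs ⟨
    total (occurrences Xs)  ≤⟨ total-mono pointwise ⟩
    total (𝟙 ∘ 𝓕)           ≡⟨ size≡total 𝓕 ⟨
    size 𝓕                  ∎
    where
    pointwise : ∀ S → occurrences Xs S ≤ 𝟙 (𝓕 S)
    pointwise S with any? (S ≟ₛ_) Xs
    ... | yes S∈Xs rewrite Xs⊆𝓕 S S∈Xs = Unique⇒occurrences≤1 {S = S} unique
    ... | no S∉Xs rewrite ∉ₗ⇒occurrences≡0 S∉Xs = z≤n

∈∪F⁺ : (𝓖 𝓗 : Family n) {S : Subset n} → S ∈F 𝓖 ⊎ S ∈F 𝓗 → S ∈F (𝓖 ∪F 𝓗)
∈∪F⁺ 𝓖 𝓗 (inj₁ S∈𝓖) rewrite S∈𝓖 = refl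
∈∪F⁺ 𝓖 𝓗 {S} (inj₂ S∈𝓗) rewrite S∈𝓗 = ∨-zeroʳ (𝓖 S)

∈Dfam⁺ : (𝓖 : Family n) (H : Subset n) {G : Subset n} {t : ℕ} → G ∈F 𝓖 → ∣ G ∩ H ∣ < t → G ∈F Dfam 𝓖 H t
∈Dfam⁺ 𝓖 H {G} {t} G∈𝓖 G∩H<t rewrite G∈𝓖 = dec-true (∣ G ∩ H ∣ <? t) G∩H<t

∈Dfam⁻ : (𝓖 : Family n) (H G : Subset n) {t : ℕ} → G ∈F Dfam 𝓖 H t → G ∈F 𝓖 × ∣ G ∩ H ∣ < t
∈Dfam⁻ 𝓖 H G {t} G∈D =
  ∧-conicalˡ (𝓖 G) _ G∈D , does≡true⇒ (∣ G ∩ H ∣ <? t) (∧-conicalʳ (𝓖 G) _ G∈D)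

members-meet : {u s : ℕ} {𝓕 : Family n} → Uniform (2 + u) 𝓕 → AlmostIntersecting s (suc u) 𝓕 →
               s + s < size 𝓕 → {P Q : Subset n} → P ∈F 𝓕 → Q ∈F 𝓕 → u ≤ ∣ P ∩ Q ∣
members-meet {n} {u} {s} {𝓕} uniform almost s+s<∣𝓕∣ {P} {Q} P∈𝓕 Q∈𝓕 with u ≤? ∣ P ∩ Q ∣
... | yes u≤∣P∩Q∣ = u≤∣P∩Q∣
... | no u≰∣P∩Q∣ = contradiction s+s<∣𝓕∣ (≤⇒≯ (begin
  size 𝓕                               ≤⟨ size-mono far-from-P-or-Q ⟩
  size (D P ∪F D Q)                    ≤⟨ size-∪F≤ (D P) (D Q) ⟩
  size (D P) + size (D Q)              ≤⟨ +-mono-≤ (almost P P∈𝓕) (almost Q Q∈𝓕) ⟩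
  s + s                                ∎))
  where
  open ≤-Reasoning
  D : Subset n → Family n
  D H = Dfam 𝓕 H (suc u)
  far-from-P-or-Q : 𝓕 ⊆F (D P ∪F D Q)
  far-from-P-or-Q X X∈𝓕 with ∣ X ∩ P ∣ <? suc u | ∣ X ∩ Q ∣ <? suc u
  ... | yes X∩P<t | _ = ∈∪F⁺ (D P) (D Q) (inj₁ (∈Dfam⁺ 𝓕 P X∈𝓕 X∩P<t))
  ... | _ | yes X∩Q<t = ∈∪F⁺ (D P) (D Q) (inj₂ (∈Dfam⁺ 𝓕 Q X∈𝓕 X∩Q<t))
  ... | no X∩P≮t | no X∩Q≮t = contradiction (begin-strict
    u + (2 + u)                          ≡⟨ +-suc u (suc u) ⟩
    suc u + suc u                        ≤⟨ +-mono-≤ (≮⇒≥ X∩P≮t) (≮⇒≥ X∩Q≮t) ⟩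
    ∣ X ∩ P ∣ + ∣ X ∩ Q ∣                ≡⟨ ∣r∩p∣+∣r∩q∣≡∣r∩p∩q∣+∣r∩[p∪q]∣ X P Q ⟩
    ∣ X ∩ P ∩ Q ∣ + ∣ X ∩ (P ∪ Q) ∣      ≤⟨ +-monoʳ-≤ _ (≤-trans (∣p∩q∣≤∣p∣ X (P ∪ Q)) (≤-reflexive (uniform X X∈𝓕))) ⟩
    ∣ X ∩ P ∩ Q ∣ + (2 + u)              <⟨ +-monoˡ-< (2 + u) (≤-<-trans (∣p∩q∣≤∣q∣ X (P ∩ Q)) (≰⇒> u≰∣P∩Q∣)) ⟩
    u + (2 + u)                          ∎) (<-irrefl refl)

-- Sets meeting two (u + 2)-sets that share u points

module Configuration {n : ℕ} (u : ℕ) (P Q : Subset n) (p₀ p₁ q₀ q₁ : Fin n)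
  (P─Q : ∀ {k} → (k ∈ P × k ∉ Q) ⇔ (k ≡ p₀ ⊎ k ≡ p₁))
  (Q─P : ∀ {k} → (k ∈ Q × k ∉ P) ⇔ (k ≡ q₀ ⊎ k ≡ q₁))
  (p₀≢p₁ : p₀ ≢ p₁) (q₀≢q₁ : q₀ ≢ q₁)
  (∣P∣≡2+u : ∣ P ∣ ≡ 2 + u) (∣Q∣≡2+u : ∣ Q ∣ ≡ 2 + u)
  where

  open Equivalence
  open ≤-Reasoning

  C U : Subset n
  C = P ∩ Q
  U = P ∪ Q

  C⊆P : C ⊆ P
  C⊆P = p∩q⊆p P Q

  C⊆Q : C ⊆ Q
  C⊆Q = p∩q⊆q P Q

  C⊆U : C ⊆ U
  C⊆U = p⊆p∪q Q ∘ C⊆P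

  ∈P─Q : ∀ {k} → k ≡ p₀ ⊎ k ≡ p₁ → k ∈ P × k ∉ Q
  ∈P─Q = from P─Q

  ∈Q─P : ∀ {k} → k ≡ q₀ ⊎ k ≡ q₁ → k ∈ Q × k ∉ P
  ∈Q─P = from Q─P

  private
    P-side : ∀ {k} → k ∈ P → k ∉ C → k ≡ p₀ ⊎ k ≡ p₁
    P-side k∈P k∉C = to P─Q (k∈P , λ k∈Q → k∉C (x∈p∩q⁺ (k∈P , k∈Q)))

    Q-side : ∀ {k} → k ∈ Q → k ∉ C → k ≡ q₀ ⊎ k ≡ q₁
    Q-side k∈Q k∉C = to Q─P (k∈Q , λ k∈P → k∉C (x∈p∩q⁺ (k∈P , k∈Q)))

    pick : ∀ S {R : Subset n} {a b : Fin n} → (∀ {k} → k ∈ R → k ∉ C → k ≡ a ⊎ k ≡ b) →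
           ∣ S ∩ C ∣ < ∣ S ∩ R ∣ → ∃ λ i → (i ≡ a ⊎ i ≡ b) × i ∈ S
    pick S {R} side ∣S∩C∣<∣S∩R∣ =
      let (i , i∈) = ∣p∩r∣<∣p∩q∣⇒Nonempty S R C ∣S∩C∣<∣S∩R∣
          (i∈S∩R , i∉C) = x∈p─q⁻ (S ∩ R) C i∈
          (i∈S , i∈R) = x∈p∩q⁻ S R i∈S∩R
      in i , side i∈R i∉C , i∈S

  ∣C∣≡u : ∣ C ∣ ≡ u
  ∣C∣≡u = +-cancelʳ-≡ 2 ∣ C ∣ u (begin-equality
    ∣ C ∣ + 2          ≡⟨ cong (∣ C ∣ +_) (trans (cong ∣_∣ P─Q≡) (∣⁅x⁆∪⁅y⁆∣≡2 p₀≢p₁)) ⟨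
    ∣ C ∣ + ∣ P ─ Q ∣  ≡⟨ ∣p∣≡∣p∩q∣+∣p─q∣ P Q ⟨
    ∣ P ∣              ≡⟨ trans ∣P∣≡2+u (+-comm 2 u) ⟩
    u + 2              ∎)
    where
    P─Q≡ : P ─ Q ≡ ⁅ p₀ ⁆ ∪ ⁅ p₁ ⁆
    P─Q≡ = ⊆-antisym (λ k∈ → x∈⁅y⁆∪⁅z⁆⁺ (to P─Q (x∈p─q⁻ P Q k∈)))
                     (λ k∈ → let (k∈P , k∉Q) = from P─Q (x∈⁅y⁆∪⁅z⁆⁻ k∈) in x∈p∧x∉q⇒x∈p─q k∈P k∉Q)

  ∣U∣≡4+u : ∣ U ∣ ≡ 4 + u
  ∣U∣≡4+u = +-cancelˡ-≡ u ∣ U ∣ (4 + u) (begin-equality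
    u + ∣ U ∣            ≡⟨ cong (_+ ∣ U ∣) ∣C∣≡u ⟨
    ∣ C ∣ + ∣ U ∣        ≡⟨ ∣p∩q∣+∣p∪q∣≡∣p∣+∣q∣ P Q ⟩
    ∣ P ∣ + ∣ Q ∣        ≡⟨ cong₂ _+_ ∣P∣≡2+u ∣Q∣≡2+u ⟩
    (2 + u) + (2 + u)    ≡⟨ trans (+-suc u (3 + u)) (cong suc (+-suc u (2 + u))) ⟨
    u + (4 + u)          ∎)

  ∣S∩C∣≤u : ∀ S → ∣ S ∩ C ∣ ≤ u
  ∣S∩C∣≤u S = ≤-trans (∣p∩q∣≤∣q∣ S C) (≤-reflexive ∣C∣≡u)

  u≤∣S∩C∣⇒C⊆S : ∀ S → u ≤ ∣ S ∩ C ∣ → C ⊆ S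
  u≤∣S∩C∣⇒C⊆S S u≤ = ∣q∣≤∣p∩q∣⇒q⊆p S C (subst (_≤ ∣ S ∩ C ∣) (sym ∣C∣≡u) u≤)

  ∣S∩P∣+∣S∩Q∣≡∣S∩C∣+∣S∩U∣ : ∀ S → ∣ S ∩ P ∣ + ∣ S ∩ Q ∣ ≡ ∣ S ∩ C ∣ + ∣ S ∩ U ∣
  ∣S∩P∣+∣S∩Q∣≡∣S∩C∣+∣S∩U∣ S = ∣r∩p∣+∣r∩q∣≡∣r∩p∩q∣+∣r∩[p∪q]∣ S P Q

  u≡∣S∩C∣+∣C─S∣ : ∀ S → u ≡ ∣ S ∩ C ∣ + ∣ C ─ S ∣
  u≡∣S∩C∣+∣C─S∣ S = trans (sym ∣C∣≡u) (trans (∣p∣≡∣p∩q∣+∣p─q∣ C S) (cong (λ X → ∣ X ∣ + ∣ C ─ S ∣) (∩-comm C S)))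

  C⊆S⊆U⇒∣S∩P∣+∣S∩Q∣≡u+∣S∣ : ∀ {S} → C ⊆ S → S ⊆ U → ∣ S ∩ P ∣ + ∣ S ∩ Q ∣ ≡ u + ∣ S ∣
  C⊆S⊆U⇒∣S∩P∣+∣S∩Q∣≡u+∣S∣ {S} C⊆S S⊆U =
    trans (∣S∩P∣+∣S∩Q∣≡∣S∩C∣+∣S∩U∣ S) (cong₂ _+_ (trans (q⊆p⇒∣p∩q∣≡∣q∣ C⊆S) ∣C∣≡u) (p⊆q⇒∣p∩q∣≡∣p∣ S⊆U))

  private
    ≡C∪ : ∀ {S a b} → ∣ S ∣ ≡ 2 + u → C ⊆ S → a ∈ S → b ∈ S → a ∉ C → b ∉ C → a ≢ b → S ≡ C ∪ (⁅ a ⁆ ∪ ⁅ b ⁆)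
    ≡C∪ ∣S∣≡ C⊆S a∈S b∈S a∉C b∉C a≢b =
      p≡r∪⁅a⁆∪⁅b⁆ C⊆S a∈S b∈S a∉C b∉C a≢b (≤-reflexive (trans ∣S∣≡ (cong (2 +_) (sym ∣C∣≡u))))

    ≡U─ : ∀ {S a b} → ∣ S ∣ ≡ 2 + u → S ⊆ U → a ∈ U → b ∈ U → a ∉ S → b ∉ S → a ≢ b → S ≡ U ─ (⁅ a ⁆ ∪ ⁅ b ⁆)
    ≡U─ ∣S∣≡ S⊆U a∈U b∈U a∉S b∉S a≢b =
      p≡q─⁅a⁆∪⁅b⁆ S⊆U a∈U b∈U a∉S b∉S a≢b (≤-reflexive (trans ∣U∣≡4+u (cong (2 +_) (sym ∣S∣≡))))

    ⊆U : ∀ S → ∣ S ∣ ≡ 2 + u → 2 + u ≤ ∣ S ∩ U ∣ → S ⊆ U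
    ⊆U S ∣S∣≡ 2+u≤ = ∣p∣≤∣p∩q∣⇒p⊆q S U (subst (_≤ ∣ S ∩ U ∣) (sym ∣S∣≡) 2+u≤)

    ∣S∩U∣≤2+u : ∀ S → ∣ S ∣ ≡ 2 + u → ∣ S ∩ U ∣ ≤ 2 + u
    ∣S∩U∣≤2+u S ∣S∣≡ = ≤-trans (∣p∩q∣≤∣p∣ S U) (≤-reflexive ∣S∣≡)

    ∣S∩U∣≤ : ∀ S {k} → u ≤ ∣ S ∩ C ∣ → ∣ S ∩ P ∣ + ∣ S ∩ Q ∣ ≤ u + k → ∣ S ∩ U ∣ ≤ k
    ∣S∩U∣≤ S {k} u≤∣S∩C∣ ∣S∩P∣+∣S∩Q∣≤ = +-cancelˡ-≤ u (∣ S ∩ U ∣) k (begin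
      u + ∣ S ∩ U ∣             ≤⟨ +-monoˡ-≤ ∣ S ∩ U ∣ u≤∣S∩C∣ ⟩
      ∣ S ∩ C ∣ + ∣ S ∩ U ∣     ≡⟨ ∣S∩P∣+∣S∩Q∣≡∣S∩C∣+∣S∩U∣ S ⟨
      ∣ S ∩ P ∣ + ∣ S ∩ Q ∣     ≤⟨ ∣S∩P∣+∣S∩Q∣≤ ⟩
      u + k                     ∎)

    ≤∣S∩U∣ : ∀ S {k} → ∣ S ∩ C ∣ + k ≤ ∣ S ∩ P ∣ + ∣ S ∩ Q ∣ → k ≤ ∣ S ∩ U ∣
    ≤∣S∩U∣ S {k} ≤∣S∩P∣+∣S∩Q∣ =
      +-cancelˡ-≤ ∣ S ∩ C ∣ k (∣ S ∩ U ∣) (≤-trans ≤∣S∩P∣+∣S∩Q∣ (≤-reflexive (∣S∩P∣+∣S∩Q∣≡∣S∩C∣+∣S∩U∣ S)))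

    2+∣S∩C∣≤∣S∩P∣ : ∀ S → p₀ ∈ S → p₁ ∈ S → 2 + ∣ S ∩ C ∣ ≤ ∣ S ∩ P ∣
    2+∣S∩C∣≤∣S∩P∣ S p₀∈S p₁∈S =
      2+∣p∩r∣≤∣p∩q∣ C⊆P p₀≢p₁ p₀∈S p₁∈S (proj₁ (∈P─Q (inj₁ refl))) (proj₁ (∈P─Q (inj₂ refl)))
                    (proj₂ (∈P─Q (inj₁ refl)) ∘ C⊆Q) (proj₂ (∈P─Q (inj₂ refl)) ∘ C⊆Q)

    2+∣S∩C∣≤∣S∩Q∣ : ∀ S → q₀ ∈ S → q₁ ∈ S → 2 + ∣ S ∩ C ∣ ≤ ∣ S ∩ Q ∣
    2+∣S∩C∣≤∣S∩Q∣ S q₀∈S q₁∈S =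
      2+∣p∩r∣≤∣p∩q∣ C⊆Q q₀≢q₁ q₀∈S q₁∈S (proj₁ (∈Q─P (inj₁ refl))) (proj₁ (∈Q─P (inj₂ refl)))
                    (proj₂ (∈Q─P (inj₁ refl)) ∘ C⊆P) (proj₂ (∈Q─P (inj₂ refl)) ∘ C⊆P)

    outside-point : ∀ S → ∣ S ∣ ≡ 2 + u → ∣ S ∩ U ∣ ≤ suc u → ∃ λ y → y ∈ S × y ∉ U
    outside-point S ∣S∣≡ ∣S∩U∣≤1+u =
      let (y , y∈S─U) = 0<∣p∣⇒Nonempty (S ─ U) (+-cancelˡ-≤ (suc u) 1 (∣ S ─ U ∣) (begin
            suc u + 1                  ≡⟨ +-comm (suc u) 1 ⟩
            2 + u                      ≡⟨ trans (sym ∣S∣≡) (∣p∣≡∣p∩q∣+∣p─q∣ S U) ⟩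
            ∣ S ∩ U ∣ + ∣ S ─ U ∣      ≤⟨ +-monoˡ-≤ ∣ S ─ U ∣ ∣S∩U∣≤1+u ⟩
            suc u + ∣ S ─ U ∣          ∎))
      in y , x∈p─q⁻ S U y∈S─U

    outside-points : ∀ S → ∣ S ∣ ≡ 2 + u → ∣ S ∩ U ∣ ≤ u → ∃₂ λ y y' → y ≢ y' × (y ∈ S × y ∉ U) × (y' ∈ S × y' ∉ U)
    outside-points S ∣S∣≡ ∣S∩U∣≤u =
      let (y , y' , y≢y' , y∈ , y'∈) = 2≤∣p∣⇒distinct-pair (S ─ U) (+-cancelˡ-≤ u 2 (∣ S ─ U ∣) (begin
            u + 2                      ≡⟨ +-comm u 2 ⟩
            2 + u                      ≡⟨ trans (sym ∣S∣≡) (∣p∣≡∣p∩q∣+∣p─q∣ S U) ⟩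
            ∣ S ∩ U ∣ + ∣ S ─ U ∣      ≤⟨ +-monoˡ-≤ ∣ S ─ U ∣ ∣S∩U∣≤u ⟩
            u + ∣ S ─ U ∣              ∎))
      in y , y' , y≢y' , x∈p─q⁻ S U y∈ , x∈p─q⁻ S U y'∈

    missing-core-point : ∀ S → ∣ S ∩ C ∣ < u → ∃ λ z → z ∈ C × z ∉ S
    missing-core-point S ∣S∩C∣<u =
      let (z , z∈C─S) = 0<∣p∣⇒Nonempty (C ─ S) (+-cancelˡ-< ∣ S ∩ C ∣ 0 (∣ C ─ S ∣) (begin-strict
            ∣ S ∩ C ∣ + 0              ≡⟨ +-identityʳ ∣ S ∩ C ∣ ⟩
            ∣ S ∩ C ∣                  <⟨ ∣S∩C∣<u ⟩
            u                          ≡⟨ u≡∣S∩C∣+∣C─S∣ S ⟩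
            ∣ S ∩ C ∣ + ∣ C ─ S ∣      ∎))
      in z , x∈p─q⁻ C S z∈C─S

    missing-core-points : ∀ S → 2 + ∣ S ∩ C ∣ ≤ u → ∃₂ λ z z' → z ≢ z' × (z ∈ C × z ∉ S) × (z' ∈ C × z' ∉ S)
    missing-core-points S 2+∣S∩C∣≤u =
      let (z , z' , z≢z' , z∈ , z'∈) = 2≤∣p∣⇒distinct-pair (C ─ S) (+-cancelˡ-≤ ∣ S ∩ C ∣ 2 (∣ C ─ S ∣) (begin
            ∣ S ∩ C ∣ + 2              ≡⟨ +-comm ∣ S ∩ C ∣ 2 ⟩
            2 + ∣ S ∩ C ∣              ≤⟨ 2+∣S∩C∣≤u ⟩
            u                          ≡⟨ u≡∣S∩C∣+∣C─S∣ S ⟩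
            ∣ S ∩ C ∣ + ∣ C ─ S ∣      ∎))
      in z , z' , z≢z' , x∈p─q⁻ C S z∈ , x∈p─q⁻ C S z'∈

  P≡C∪⁅p₀⁆∪⁅p₁⁆ : P ≡ C ∪ (⁅ p₀ ⁆ ∪ ⁅ p₁ ⁆)
  P≡C∪⁅p₀⁆∪⁅p₁⁆ = ≡C∪ {P} {p₀} {p₁} ∣P∣≡2+u C⊆P (proj₁ (∈P─Q (inj₁ refl))) (proj₁ (∈P─Q (inj₂ refl)))
                       (proj₂ (∈P─Q (inj₁ refl)) ∘ C⊆Q) (proj₂ (∈P─Q (inj₂ refl)) ∘ C⊆Q) p₀≢p₁

  both-large : ∀ S → ∣ S ∣ ≡ 2 + u → suc u ≤ ∣ S ∩ P ∣ → suc u ≤ ∣ S ∩ Q ∣ →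
               ∃₂ λ i j → (i ≡ p₀ ⊎ i ≡ p₁) × (j ≡ q₀ ⊎ j ≡ q₁) × S ≡ C ∪ (⁅ i ⁆ ∪ ⁅ j ⁆)
  both-large S ∣S∣≡ u<∣S∩P∣ u<∣S∩Q∣ =
    let (i , i∈P─Q , i∈S) = pick S P-side (≤-trans (s≤s (∣S∩C∣≤u S)) u<∣S∩P∣)
        (j , j∈Q─P , j∈S) = pick S Q-side (≤-trans (s≤s (∣S∩C∣≤u S)) u<∣S∩Q∣)
        (i∈P , i∉Q) = ∈P─Q i∈P─Q
        (_ , j∉P) = ∈Q─P j∈Q─P
    in i , j , i∈P─Q , j∈Q─P ,
       ≡C∪ ∣S∣≡ C⊆S i∈S j∈S (i∉Q ∘ C⊆Q) (j∉P ∘ C⊆P) (λ i≡j → j∉P (subst (_∈ P) i≡j i∈P))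
    where
    C⊆S : C ⊆ S
    C⊆S = u≤∣S∩C∣⇒C⊆S S (+-cancelʳ-≤ (2 + u) u ∣ S ∩ C ∣ (begin
      u + (2 + u)              ≡⟨ +-suc u (suc u) ⟩
      suc u + suc u            ≤⟨ +-mono-≤ u<∣S∩P∣ u<∣S∩Q∣ ⟩
      ∣ S ∩ P ∣ + ∣ S ∩ Q ∣    ≡⟨ ∣S∩P∣+∣S∩Q∣≡∣S∩C∣+∣S∩U∣ S ⟩
      ∣ S ∩ C ∣ + ∣ S ∩ U ∣    ≤⟨ +-monoʳ-≤ ∣ S ∩ C ∣ (∣S∩U∣≤2+u S ∣S∣≡) ⟩
      ∣ S ∩ C ∣ + (2 + u)      ∎))

  one-large : ∀ S → ∣ S ∣ ≡ 2 + u → suc u ≤ ∣ S ∩ P ∣ → ∣ S ∩ Q ∣ ≡ u →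
      S ≡ P
    ⊎ (∃₂ λ i y → (i ≡ p₀ ⊎ i ≡ p₁) × y ∉ U × S ≡ C ∪ (⁅ i ⁆ ∪ ⁅ y ⁆))
    ⊎ (∃₂ λ j z → (j ≡ q₀ ⊎ j ≡ q₁) × z ∈ C × S ≡ U ─ (⁅ j ⁆ ∪ ⁅ z ⁆))
  one-large S ∣S∣≡ u<∣S∩P∣ ∣S∩Q∣≡u with u ≤? ∣ S ∩ C ∣ | ∣ S ∣ ≤? ∣ S ∩ P ∣
  ... | yes _ | yes ∣S∣≤∣S∩P∣ =
    inj₁ (p⊆q∧∣q∣≤∣p∣⇒p≡q (∣p∣≤∣p∩q∣⇒p⊆q S P ∣S∣≤∣S∩P∣) (≤-reflexive (trans ∣P∣≡2+u (sym ∣S∣≡))))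
  ... | yes u≤∣S∩C∣ | no ∣S∣≰∣S∩P∣ =
    let ∣S∩P∣≤1+u = ≤-pred (subst (∣ S ∩ P ∣ <_) ∣S∣≡ (≰⇒> ∣S∣≰∣S∩P∣))
        (i , i∈P─Q , i∈S) = pick S P-side (≤-trans (s≤s (∣S∩C∣≤u S)) u<∣S∩P∣)
        (i∈P , i∉Q) = ∈P─Q i∈P─Q
        (y , y∈S , y∉U) = outside-point S ∣S∣≡ (∣S∩U∣≤ S u≤∣S∩C∣
                            (≤-trans (+-mono-≤ ∣S∩P∣≤1+u (≤-reflexive ∣S∩Q∣≡u)) (≤-reflexive (+-comm (suc u) u))))
    in inj₂ (inj₁ (i , y , i∈P─Q , y∉U ,
         ≡C∪ ∣S∣≡ (u≤∣S∩C∣⇒C⊆S S u≤∣S∩C∣) i∈S y∈S (i∉Q ∘ C⊆Q) (y∉U ∘ C⊆U)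
             (λ i≡y → y∉U (subst (_∈ U) i≡y (p⊆p∪q Q i∈P)))))
  ... | no u≰∣S∩C∣ | _ with both-or-missing S q₀ q₁
  ...   | inj₁ (q₀∈S , q₁∈S) = contradiction (≤∣S∩U∣ S (begin
      ∣ S ∩ C ∣ + (3 + u)         ≡⟨ +-suc ∣ S ∩ C ∣ (2 + u) ⟩
      suc (∣ S ∩ C ∣ + (2 + u))   ≡⟨ cong suc (+-suc ∣ S ∩ C ∣ (suc u)) ⟩
      (2 + ∣ S ∩ C ∣) + suc u     ≤⟨ +-mono-≤ (2+∣S∩C∣≤∣S∩Q∣ S q₀∈S q₁∈S) u<∣S∩P∣ ⟩
      ∣ S ∩ Q ∣ + ∣ S ∩ P ∣       ≡⟨ +-comm ∣ S ∩ Q ∣ ∣ S ∩ P ∣ ⟩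
      ∣ S ∩ P ∣ + ∣ S ∩ Q ∣       ∎)) (<⇒≱ (s≤s (∣S∩U∣≤2+u S ∣S∣≡)))
  ...   | inj₂ (j , j∈Q─P , j∉S) =
    let (z , z∈C , z∉S) = missing-core-point S (≰⇒> u≰∣S∩C∣)
        (j∈Q , j∉P) = ∈Q─P j∈Q─P
    in inj₂ (inj₂ (j , z , j∈Q─P , z∈C ,
         ≡U─ ∣S∣≡ (⊆U S ∣S∣≡ 2+u≤∣S∩U∣) (q⊆p∪q P Q j∈Q) (C⊆U z∈C) j∉S z∉S
             (λ j≡z → j∉P (C⊆P (subst (_∈ C) (sym j≡z) z∈C)))))
    where
    2+u≤∣S∩U∣ : 2 + u ≤ ∣ S ∩ U ∣
    2+u≤∣S∩U∣ = ≤∣S∩U∣ S (begin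
      ∣ S ∩ C ∣ + (2 + u)         ≡⟨ +-suc ∣ S ∩ C ∣ (suc u) ⟩
      suc ∣ S ∩ C ∣ + suc u       ≤⟨ +-monoˡ-≤ (suc u) (≰⇒> u≰∣S∩C∣) ⟩
      u + suc u                   ≡⟨ +-comm u (suc u) ⟩
      suc u + u                   ≤⟨ +-mono-≤ u<∣S∩P∣ (≤-reflexive (sym ∣S∩Q∣≡u)) ⟩
      ∣ S ∩ P ∣ + ∣ S ∩ Q ∣       ∎)

  private
    far-from-core : ∀ S → ∣ S ∣ ≡ 2 + u → ∣ S ∩ P ∣ ≡ u → ∣ S ∩ Q ∣ ≡ u → 2 + ∣ S ∩ C ∣ ≤ u →
                    ∃₂ λ z z' → z ≢ z' × z ∈ C × z' ∈ C × S ≡ U ─ (⁅ z ⁆ ∪ ⁅ z' ⁆)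
    far-from-core S ∣S∣≡ ∣S∩P∣≡u ∣S∩Q∣≡u 2+∣S∩C∣≤u =
      let (z , z' , z≢z' , (z∈C , z∉S) , (z'∈C , z'∉S)) = missing-core-points S 2+∣S∩C∣≤u
      in z , z' , z≢z' , z∈C , z'∈C , ≡U─ ∣S∣≡ (⊆U S ∣S∣≡ 2+u≤∣S∩U∣) (C⊆U z∈C) (C⊆U z'∈C) z∉S z'∉S z≢z'
      where
      2+u≤∣S∩U∣ : 2 + u ≤ ∣ S ∩ U ∣
      2+u≤∣S∩U∣ = ≤∣S∩U∣ S (begin
        ∣ S ∩ C ∣ + (2 + u)       ≡⟨ +-assoc ∣ S ∩ C ∣ 2 u ⟨
        (∣ S ∩ C ∣ + 2) + u       ≡⟨ cong (_+ u) (+-comm ∣ S ∩ C ∣ 2) ⟩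
        (2 + ∣ S ∩ C ∣) + u       ≤⟨ +-monoˡ-≤ u 2+∣S∩C∣≤u ⟩
        u + u                     ≡⟨ cong₂ _+_ ∣S∩P∣≡u ∣S∩Q∣≡u ⟨
        ∣ S ∩ P ∣ + ∣ S ∩ Q ∣     ∎)

  neither-large : ∀ S → ∣ S ∣ ≡ 2 + u → ∣ S ∩ P ∣ ≡ u → ∣ S ∩ Q ∣ ≡ u →
      (∃₂ λ y y' → y ≢ y' × y ∉ U × y' ∉ U × S ≡ C ∪ (⁅ y ⁆ ∪ ⁅ y' ⁆))
    ⊎ (∃₂ λ z z' → z ≢ z' × z ∈ C × z' ∈ C × S ≡ U ─ (⁅ z ⁆ ∪ ⁅ z' ⁆))
    ⊎ (∃₂ λ i j → (i ≡ p₀ ⊎ i ≡ p₁) × (j ≡ q₀ ⊎ j ≡ q₁) × i ∉ S × j ∉ S × ∣ S ∩ C ∣ < u)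
  neither-large S ∣S∣≡ ∣S∩P∣≡u ∣S∩Q∣≡u with u ≤? ∣ S ∩ C ∣
  ... | yes u≤∣S∩C∣ =
    let (y , y' , y≢y' , (y∈S , y∉U) , (y'∈S , y'∉U)) =
          outside-points S ∣S∣≡ (∣S∩U∣≤ S u≤∣S∩C∣ (≤-reflexive (cong₂ _+_ ∣S∩P∣≡u ∣S∩Q∣≡u)))
    in inj₁ (y , y' , y≢y' , y∉U , y'∉U , ≡C∪ ∣S∣≡ (u≤∣S∩C∣⇒C⊆S S u≤∣S∩C∣) y∈S y'∈S (y∉U ∘ C⊆U) (y'∉U ∘ C⊆U) y≢y')
  ... | no u≰∣S∩C∣ with both-or-missing S p₀ p₁ | both-or-missing S q₀ q₁
  ...   | inj₁ (p₀∈S , p₁∈S) | _ =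
    inj₂ (inj₁ (far-from-core S ∣S∣≡ ∣S∩P∣≡u ∣S∩Q∣≡u (subst (2 + ∣ S ∩ C ∣ ≤_) ∣S∩P∣≡u (2+∣S∩C∣≤∣S∩P∣ S p₀∈S p₁∈S))))
  ...   | inj₂ _ | inj₁ (q₀∈S , q₁∈S) =
    inj₂ (inj₁ (far-from-core S ∣S∣≡ ∣S∩P∣≡u ∣S∩Q∣≡u (subst (2 + ∣ S ∩ C ∣ ≤_) ∣S∩Q∣≡u (2+∣S∩C∣≤∣S∩Q∣ S q₀∈S q₁∈S))))
  ...   | inj₂ (i , i∈P─Q , i∉S) | inj₂ (j , j∈Q─P , j∉S) =
    inj₂ (inj₂ (i , j , i∈P─Q , j∈Q─P , i∉S , j∉S , ≰⇒> u≰∣S∩C∣))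

-- An admissible family with 2s + 3 members

module _ {A B : Set} where

  Unique-map⁺-on : {P : A → Set} {f : A → B} → (∀ {x y} → P x → f x ≡ f y → x ≡ y) →
                   {xs : List A} → All P xs → Unique xs → Unique (map f xs)
  Unique-map⁺-on inj [] [] = []
  Unique-map⁺-on inj (px ∷ pxs) (x∉ ∷ unique) =
    All.map⁺ (All.map (λ x≢y fx≡fy → x≢y (inj px fx≡fy)) x∉) ∷ Unique-map⁺-on inj pxs unique

two-distinct-members : {A : Set} {xs : List A} → 2 ≤ length xs → Unique xs → ∃₂ λ x y → x ≢ y × x ∈ₗ xs × y ∈ₗ xs
two-distinct-members {xs = x ∷ y ∷ _} _ ((x≢y ∷ _) ∷ _) = x , y , x≢y , here refl , there (here refl)
two-distinct-members {xs = _ ∷ []} (s≤s ()) _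

-- C⁺ eᵢ y is far only from the s sets C⁺ e₁₋ᵢ y' with y' ≠ y, and A₀ = C⁺ e₀ e₁ from none.
module LowerBound {n : ℕ} (u s : ℕ) (C : Subset n) (e₀ e₁ : Fin n)
  (∣C∣≡u : ∣ C ∣ ≡ u) (e₀∉C : e₀ ∉ C) (e₁∉C : e₁ ∉ C) (e₀≢e₁ : e₀ ≢ e₁) (1≤s : 1 ≤ s)
  (Y : List (Fin n)) (∣Y∣≡1+s : length Y ≡ suc s) (Y-unique : Unique Y)
  (Y∩A₀≡∅ : All (_∉ C ∪ (⁅ e₀ ⁆ ∪ ⁅ e₁ ⁆)) Y)
  where

  C⁺ : Fin n → Fin n → Subset n
  C⁺ i y = C ∪ (⁅ i ⁆ ∪ ⁅ y ⁆)

  A₀ : Subset n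
  A₀ = C⁺ e₀ e₁

  Index : Fin n → Set
  Index i = i ≡ e₀ ⊎ i ≡ e₁

  private
    C⊆C⁺ : ∀ {i y} → C ⊆ C⁺ i y
    C⊆C⁺ = p⊆p∪q _

    i∈C⁺ : ∀ {i y} → i ∈ C⁺ i y
    i∈C⁺ = q⊆p∪q C _ (x∈⁅y⁆∪⁅z⁆⁺ (inj₁ refl))

    y∈C⁺ : ∀ {i y} → y ∈ C⁺ i y
    y∈C⁺ = q⊆p∪q C _ (x∈⁅y⁆∪⁅z⁆⁺ (inj₂ refl))

    ∈C⁺⁻ : ∀ {k i y} → k ∈ C⁺ i y → k ∈ C ⊎ k ≡ i ⊎ k ≡ y
    ∈C⁺⁻ k∈ = Sum.map₂ x∈⁅y⁆∪⁅z⁆⁻ (x∈p∪q⁻ C _ k∈)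

    index∉C : ∀ {i} → Index i → i ∉ C
    index∉C (inj₁ refl) = e₀∉C
    index∉C (inj₂ refl) = e₁∉C

    index∈A₀ : ∀ {i} → Index i → i ∈ A₀
    index∈A₀ (inj₁ refl) = i∈C⁺
    index∈A₀ (inj₂ refl) = y∈C⁺

    ∣C⁺∣≡2+u : ∀ {i y} → i ∉ C → y ∉ C → i ≢ y → ∣ C⁺ i y ∣ ≡ 2 + u
    ∣C⁺∣≡2+u i∉C y∉C i≢y = trans (∣p∪⁅x⁆∪⁅y⁆∣≡2+∣p∣ C i∉C y∉C i≢y) (cong (2 +_) ∣C∣≡u)

    y∉A₀ : ∀ {y} → y ∈ₗ Y → y ∉ A₀
    y∉A₀ = All.lookup Y∩A₀≡∅

  members-beyond-A₀ : List (Subset n)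
  members-beyond-A₀ = map (C⁺ e₀) Y ++ map (C⁺ e₁) Y

  members : List (Subset n)
  members = A₀ ∷ members-beyond-A₀

  𝓚 : Family n
  𝓚 S = does (any? (S ≟ₛ_) members)

  private
    ∈𝓚⁻ : ∀ S → S ∈F 𝓚 → S ∈ₗ members
    ∈𝓚⁻ S = does≡true⇒ (any? (S ≟ₛ_) members)

    C⁺∈𝓚 : ∀ {i y} → Index i → y ∈ₗ Y → C⁺ i y ∈F 𝓚
    C⁺∈𝓚 {i} {y} (inj₁ refl) y∈Y = dec-true (any? (C⁺ i y ≟ₛ_) members) (there (∈-++⁺ˡ (∈-map⁺ (C⁺ e₀) y∈Y)))
    C⁺∈𝓚 {i} {y} (inj₂ refl) y∈Y = dec-true (any? (C⁺ i y ≟ₛ_) members) (there (∈-++⁺ʳ (map (C⁺ e₀) Y) (∈-map⁺ (C⁺ e₁) y∈Y)))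

    beyond-A₀-shape : ∀ {S} → S ∈ₗ members-beyond-A₀ → ∃₂ λ i y → Index i × y ∈ₗ Y × S ≡ C⁺ i y
    beyond-A₀-shape S∈ with ∈-++⁻ (map (C⁺ e₀) Y) S∈
    ... | inj₁ S∈₀ with ∈-map⁻ (C⁺ e₀) S∈₀
    ...   | y , y∈Y , S≡ = e₀ , y , inj₁ refl , y∈Y , S≡
    beyond-A₀-shape S∈ | inj₂ S∈₁ with ∈-map⁻ (C⁺ e₁) S∈₁
    ...   | y , y∈Y , S≡ = e₁ , y , inj₂ refl , y∈Y , S≡

    member-shape : ∀ {S} → S ∈ₗ members → S ≡ A₀ ⊎ ∃₂ λ i y → Index i × y ∈ₗ Y × S ≡ C⁺ i y
    member-shape (here S≡A₀) = inj₁ S≡A₀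
    member-shape (there S∈) = inj₂ (beyond-A₀-shape S∈)

    y∉C : ∀ {y} → y ∈ₗ Y → y ∉ C
    y∉C y∈Y = y∉A₀ y∈Y ∘ C⊆C⁺

    y≢index : ∀ {i y} → Index i → y ∈ₗ Y → y ≢ i
    y≢index i-idx y∈Y refl = y∉A₀ y∈Y (index∈A₀ i-idx)

    meet-beyond-C : ∀ {X Z k} → C ⊆ X → C ⊆ Z → k ∈ X → k ∈ Z → k ∉ C → suc u ≤ ∣ X ∩ Z ∣
    meet-beyond-C C⊆X C⊆Z k∈X k∈Z k∉C = subst (λ c → suc c ≤ _) ∣C∣≡u (1+∣r∣≤∣p∩q∣ C⊆X C⊆Z k∈X k∈Z k∉C)

    index-cases : ∀ {i i' j} → Index i → Index i' → i ≢ i' → Index j → j ≡ i ⊎ j ≡ i'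
    index-cases (inj₁ refl) (inj₁ refl) i≢i' _ = contradiction refl i≢i'
    index-cases (inj₁ refl) (inj₂ refl) _ j-idx = j-idx
    index-cases (inj₂ refl) (inj₁ refl) _ j-idx = Sum.swap j-idx
    index-cases (inj₂ refl) (inj₂ refl) i≢i' _ = contradiction refl i≢i'

  uniform : Uniform (2 + u) 𝓚
  uniform S S∈𝓚 with member-shape (∈𝓚⁻ S S∈𝓚)
  ... | inj₁ refl = ∣C⁺∣≡2+u e₀∉C e₁∉C e₀≢e₁
  ... | inj₂ (i , y , i-idx , y∈Y , refl) = ∣C⁺∣≡2+u (index∉C i-idx) (y∉C y∈Y) (y≢index i-idx y∈Y ∘ sym)

  not-intersecting : ¬ Intersecting (suc u) 𝓚
  not-intersecting intersecting with two-distinct-members (subst (2 ≤_) (sym ∣Y∣≡1+s) (s≤s 1≤s)) Y-unique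
  ... | y₁ , y₂ , y₁≢y₂ , y₁∈Y , y₂∈Y = 1+n≰n (begin
    suc u                      ≤⟨ intersecting _ _ (C⁺∈𝓚 (inj₁ refl) y₁∈Y) (C⁺∈𝓚 (inj₂ refl) y₂∈Y) ⟩
    ∣ C⁺ e₀ y₁ ∩ C⁺ e₁ y₂ ∣    ≤⟨ p⊆q⇒∣p∣≤∣q∣ ∩⊆C ⟩
    ∣ C ∣                      ≡⟨ ∣C∣≡u ⟩
    u                          ∎)
    where
    open ≤-Reasoning
    ∩⊆C : C⁺ e₀ y₁ ∩ C⁺ e₁ y₂ ⊆ C
    ∩⊆C k∈ with x∈p∩q⁻ (C⁺ e₀ y₁) _ k∈
    ... | k∈₀ , k∈₁ with ∈C⁺⁻ k∈₀ | ∈C⁺⁻ k∈₁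
    ... | inj₁ k∈C | _ = k∈C
    ... | _ | inj₁ k∈C = k∈C
    ... | inj₂ (inj₁ refl) | inj₂ (inj₁ e₀≡e₁) = contradiction e₀≡e₁ e₀≢e₁
    ... | inj₂ (inj₁ refl) | inj₂ (inj₂ e₀≡y₂) = contradiction (sym e₀≡y₂) (y≢index (inj₁ refl) y₂∈Y)
    ... | inj₂ (inj₂ refl) | inj₂ (inj₁ y₁≡e₁) = contradiction y₁≡e₁ (y≢index (inj₂ refl) y₁∈Y)
    ... | inj₂ (inj₂ refl) | inj₂ (inj₂ y₁≡y₂) = contradiction y₁≡y₂ y₁≢y₂

  private
    size-D[A₀]≤0 : size (Dfam 𝓚 A₀ (suc u)) ≤ 0
    size-D[A₀]≤0 = size≤length (Dfam 𝓚 A₀ (suc u)) [] far-from-A₀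
      where
      far-from-A₀ : ∀ Z → Z ∈F Dfam 𝓚 A₀ (suc u) → Z ∈ₗ []
      far-from-A₀ Z Z∈D with ∈Dfam⁻ 𝓚 A₀ Z Z∈D
      ... | Z∈𝓚 , ∣Z∩A₀∣<t with member-shape (∈𝓚⁻ Z Z∈𝓚)
      ...   | inj₁ refl = contradiction (meet-beyond-C C⊆C⁺ C⊆C⁺ i∈C⁺ i∈C⁺ e₀∉C) (<⇒≱ ∣Z∩A₀∣<t)
      ...   | inj₂ (i , _ , i-idx , _ , refl) =
        contradiction (meet-beyond-C C⊆C⁺ C⊆C⁺ i∈C⁺ (index∈A₀ i-idx) (index∉C i-idx)) (<⇒≱ ∣Z∩A₀∣<t)

    size-D[C⁺]≤s : ∀ {i i' y} → Index i → Index i' → i ≢ i' → y ∈ₗ Y → size (Dfam 𝓚 (C⁺ i y) (suc u)) ≤ s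
    size-D[C⁺]≤s {i} {i'} {y} i-idx i'-idx i≢i' y∈Y = ≤-pred (subst (_ ≤_) (trans (length-map (C⁺ i') Y) ∣Y∣≡1+s)
      (size<length (Dfam 𝓚 (C⁺ i y) (suc u)) (map (C⁺ i') Y) D⊆ (∈-map⁺ (C⁺ i') y∈Y) C⁺i'y∉D))
      where
      C⁺i'y∉D : ¬ C⁺ i' y ∈F Dfam 𝓚 (C⁺ i y) (suc u)
      C⁺i'y∉D C⁺i'y∈D = <⇒≱ (proj₂ (∈Dfam⁻ 𝓚 (C⁺ i y) (C⁺ i' y) C⁺i'y∈D)) (meet-beyond-C (C⊆C⁺ {i'}) (C⊆C⁺ {i}) (y∈C⁺ {i'}) (y∈C⁺ {i}) (y∉C y∈Y))
      D⊆ : ∀ Z → Z ∈F Dfam 𝓚 (C⁺ i y) (suc u) → Z ∈ₗ map (C⁺ i') Y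
      D⊆ Z Z∈D with ∈Dfam⁻ 𝓚 (C⁺ i y) Z Z∈D
      ... | Z∈𝓚 , ∣Z∩C⁺∣<t with member-shape (∈𝓚⁻ Z Z∈𝓚)
      ...   | inj₁ refl =
        contradiction (meet-beyond-C C⊆C⁺ C⊆C⁺ (index∈A₀ i-idx) i∈C⁺ (index∉C i-idx)) (<⇒≱ ∣Z∩C⁺∣<t)
      ...   | inj₂ (j , y' , j-idx , y'∈Y , refl) with index-cases i-idx i'-idx i≢i' j-idx
      ...     | inj₁ refl = contradiction (meet-beyond-C C⊆C⁺ C⊆C⁺ i∈C⁺ i∈C⁺ (index∉C i-idx)) (<⇒≱ ∣Z∩C⁺∣<t)
      ...     | inj₂ refl = ∈-map⁺ (C⁺ i') y'∈Y

  almost-intersecting : AlmostIntersecting s (suc u) 𝓚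
  almost-intersecting S S∈𝓚 with member-shape (∈𝓚⁻ S S∈𝓚)
  ... | inj₁ refl = ≤-trans size-D[A₀]≤0 z≤n
  ... | inj₂ (_ , _ , inj₁ refl , y∈Y , refl) = size-D[C⁺]≤s (inj₁ refl) (inj₂ refl) e₀≢e₁ y∈Y
  ... | inj₂ (_ , _ , inj₂ refl , y∈Y , refl) = size-D[C⁺]≤s (inj₂ refl) (inj₁ refl) (e₀≢e₁ ∘ sym) y∈Y

  private
    C⁺-injective : ∀ {i y y'} → Index i → y ∉ A₀ → C⁺ i y ≡ C⁺ i y' → y ≡ y'
    C⁺-injective i-idx y∉A₀' C⁺y≡C⁺y' with ∈C⁺⁻ (subst (_ ∈_) C⁺y≡C⁺y' y∈C⁺)
    ... | inj₁ y∈C = contradiction (C⊆C⁺ y∈C) y∉A₀'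
    ... | inj₂ (inj₁ refl) = contradiction (index∈A₀ i-idx) y∉A₀'
    ... | inj₂ (inj₂ y≡y') = y≡y'

    map-C⁺-unique : ∀ {i} → Index i → Unique (map (C⁺ i) Y)
    map-C⁺-unique i-idx = Unique-map⁺-on (C⁺-injective i-idx) (All.tabulate y∉A₀) Y-unique

    members-unique : Unique members
    members-unique = All.tabulate A₀≢ ∷ ++⁺ (map-C⁺-unique (inj₁ refl)) (map-C⁺-unique (inj₂ refl)) disjoint
      where
      A₀≢ : ∀ {S} → S ∈ₗ members-beyond-A₀ → A₀ ≢ S
      A₀≢ S∈ A₀≡S with beyond-A₀-shape S∈
      ... | _ , y , _ , y∈Y , S≡ = y∉A₀ y∈Y (subst (y ∈_) (sym (trans A₀≡S S≡)) y∈C⁺)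
      disjoint : ∀ {S} → ¬ (S ∈ₗ map (C⁺ e₀) Y × S ∈ₗ map (C⁺ e₁) Y)
      disjoint (S∈₀ , S∈₁) with ∈-map⁻ (C⁺ e₀) S∈₀ | ∈-map⁻ (C⁺ e₁) S∈₁
      ... | y , _ , refl | y' , y'∈Y , C⁺₀≡C⁺₁ with ∈C⁺⁻ (subst (e₀ ∈_) C⁺₀≡C⁺₁ i∈C⁺)
      ...   | inj₁ e₀∈C = e₀∉C e₀∈C
      ...   | inj₂ (inj₁ e₀≡e₁) = e₀≢e₁ e₀≡e₁
      ...   | inj₂ (inj₂ e₀≡y') = y≢index (inj₁ refl) y'∈Y (sym e₀≡y')

    length-members : length members ≡ 3 + (s + s)
    length-members = cong suc (begin-equality
      length (map (C⁺ e₀) Y ++ map (C⁺ e₁) Y)    ≡⟨ length-++ (map (C⁺ e₀) Y) ⟩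
      length (map (C⁺ e₀) Y) + length (map (C⁺ e₁) Y) ≡⟨ cong₂ _+_ (trans (length-map _ Y) ∣Y∣≡1+s) (trans (length-map _ Y) ∣Y∣≡1+s) ⟩
      suc s + suc s                              ≡⟨ cong suc (+-suc s s) ⟩
      2 + (s + s)                                ∎)
      where open ≤-Reasoning

  admissible-family : Σ (Family n) λ 𝓚 → Admissible s (suc u) 𝓚 × 3 + (s + s) ≤ size 𝓚
  admissible-family = 𝓚 , (uniform , almost-intersecting , not-intersecting) ,
    ≤-trans (≤-reflexive (sym length-members)) (length≤size 𝓚 members members-unique λ S S∈ → dec-true (any? (S ≟ₛ_) members) S∈)

X-outside : (A B : Subset n) (i : Fin n) {x : Fin n} → x ∉ A ∩ B → X A B i x ≡ (A ∩ B) ∪ (⁅ i ⁆ ∪ ⁅ x ⁆)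
X-outside A B i {x} x∉A∩B with x ∈? A ∩ B
... | yes x∈A∩B = contradiction x∈A∩B x∉A∩B
... | no _ = refl

X-inside : (A B : Subset n) (i : Fin n) {x : Fin n} → x ∈ A ∩ B → X A B i x ≡ (A ∪ B) ─ (⁅ i ⁆ ∪ ⁅ x ⁆)
X-inside A B i {x} x∈A∩B with x ∈? A ∩ B
... | yes _ = refl
... | no x∉A∩B = contradiction x∈A∩B x∉A∩B

X-outside∩X-inside⊆ : (A B : Subset n) (i : Fin n) {x y : Fin n} → y ∉ A ∪ B → x ∈ A ∩ B →
                      X A B i y ∩ X A B i x ⊆ (A ∩ B) - x
X-outside∩X-inside⊆ A B i {x} {y} y∉A∪B x∈A∩B =
  subst₂ (λ S T → S ∩ T ⊆ (A ∩ B) - x)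
         (sym (X-outside A B i (y∉A∪B ∘ p⊆p∪q B ∘ p∩q⊆p A B))) (sym (X-inside A B i x∈A∩B)) sub
  where
  sub : ((A ∩ B) ∪ (⁅ i ⁆ ∪ ⁅ y ⁆)) ∩ ((A ∪ B) ─ (⁅ i ⁆ ∪ ⁅ x ⁆)) ⊆ (A ∩ B) - x
  sub k∈ with x∈p∩q⁻ ((A ∩ B) ∪ (⁅ i ⁆ ∪ ⁅ y ⁆)) _ k∈
  ... | k∈C∪iy , k∈U─ix with x∈p─q⁻ (A ∪ B) (⁅ i ⁆ ∪ ⁅ x ⁆) k∈U─ix | x∈p∪q⁻ (A ∩ B) (⁅ i ⁆ ∪ ⁅ y ⁆) k∈C∪iy
  ...   | _ , k∉ix | inj₁ k∈C = x∈p∧x∉q⇒x∈p─q k∈C (k∉ix ∘ q⊆p∪q ⁅ i ⁆ ⁅ x ⁆)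
  ...   | k∈U , k∉ix | inj₂ k∈iy with x∈⁅y⁆∪⁅z⁆⁻ k∈iy
  ...     | inj₁ k≡i = contradiction (x∈⁅y⁆∪⁅z⁆⁺ (inj₁ k≡i)) k∉ix
  ...     | inj₂ refl = contradiction k∈U y∉A∪B

-- Maximum families

module Maximal {n u s : ℕ} {𝓕 : Family n} {A B : Subset n}
  (1≤s : 1 ≤ s) (n-large : suc u + s + 2 ≤ n)
  (admissible : Admissible s (suc u) 𝓕)
  (maximum : ∀ (𝓕' : Family n) → Admissible s (suc u) 𝓕' → size 𝓕' ≤ size 𝓕)
  (A∈𝓕 : A ∈F 𝓕) (B∈𝓕 : B ∈F 𝓕)
  (A─B : ∀ x → (x ∈ A × x ∉ B) ⇔ (toℕ x ≡ 0 ⊎ toℕ x ≡ 1))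
  (B─A : ∀ x → (x ∈ B × x ∉ A) ⇔ (toℕ x ≡ 2 ⊎ toℕ x ≡ 3))
  where

  open Equivalence
  open ≤-Reasoning

  private
    uniform : Uniform (2 + u) 𝓕
    uniform = proj₁ admissible

    almost : AlmostIntersecting s (suc u) 𝓕
    almost = proj₁ (proj₂ admissible)

    4≤n : 4 ≤ n
    4≤n = ≤-trans (+-monoˡ-≤ 2 (+-mono-≤ (s≤s z≤n) 1≤s)) n-large

    point : ∀ k → k < 4 → Fin n
    point k k<4 = fromℕ< (<-≤-trans k<4 4≤n)

    toℕ≡⇔≡point : ∀ {x k} (k<4 : k < 4) → toℕ x ≡ k ⇔ x ≡ point k k<4
    toℕ≡⇔≡point k<4 = mk⇔ (λ toℕx≡k → toℕ-injective (trans toℕx≡k (sym (toℕ-fromℕ< _)))) λ { refl → toℕ-fromℕ< _ }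

    point-injective : ∀ {j k} (j<4 : j < 4) (k<4 : k < 4) → point j j<4 ≡ point k k<4 → j ≡ k
    point-injective _ _ eq = trans (sym (toℕ-fromℕ< _)) (trans (cong toℕ eq) (toℕ-fromℕ< _))

  e₀ e₁ e₂ e₃ : Fin n
  e₀ = point 0 z<s
  e₁ = point 1 (s<s z<s)
  e₂ = point 2 (s<s (s<s z<s))
  e₃ = point 3 (s<s (s<s (s<s z<s)))

  Δ : Fin n → Set
  Δ x = (x ∈ A × x ∉ B) ⊎ (x ∈ B × x ∉ A)

  <4⇒Δ : ∀ {x} → toℕ x < 4 → Δ x
  <4⇒Δ {x} x<4 with toℕ x in toℕx≡
  ... | 0 = inj₁ (from (A─B x) (inj₁ toℕx≡))
  ... | 1 = inj₁ (from (A─B x) (inj₂ toℕx≡))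
  ... | 2 = inj₂ (from (B─A x) (inj₁ toℕx≡))
  ... | 3 = inj₂ (from (B─A x) (inj₂ toℕx≡))
  ... | suc (suc (suc (suc _))) = contradiction x<4 λ { (s≤s (s≤s (s≤s (s≤s ())))) }

  Δ⇒<4 : ∀ {x} → Δ x → toℕ x < 4
  Δ⇒<4 {x} (inj₁ x∈A─B) with to (A─B x) x∈A─B
  ... | inj₁ toℕx≡0 = subst (_< 4) (sym toℕx≡0) z<s
  ... | inj₂ toℕx≡1 = subst (_< 4) (sym toℕx≡1) (s<s z<s)
  Δ⇒<4 {x} (inj₂ x∈B─A) with to (B─A x) x∈B─A
  ... | inj₁ toℕx≡2 = subst (_< 4) (sym toℕx≡2) (s<s (s<s z<s))
  ... | inj₂ toℕx≡3 = subst (_< 4) (sym toℕx≡3) (s<s (s<s (s<s z<s)))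

  Δ⇒∈A∪B : ∀ {x} → Δ x → x ∈ A ∪ B
  Δ⇒∈A∪B (inj₁ (x∈A , _)) = p⊆p∪q B x∈A
  Δ⇒∈A∪B (inj₂ (x∈B , _)) = q⊆p∪q A B x∈B

  Δ⇒∉A∩B : ∀ {x} → Δ x → x ∉ A ∩ B
  Δ⇒∉A∩B (inj₁ (_ , x∉B)) = x∉B ∘ p∩q⊆q A B
  Δ⇒∉A∩B (inj₂ (_ , x∉A)) = x∉A ∘ p∩q⊆p A B

  ¬Δ⇒4≤ : ∀ {x} → ¬ Δ x → 4 ≤ toℕ x
  ¬Δ⇒4≤ {x} ¬Δx with 4 ≤? toℕ x
  ... | yes 4≤x = 4≤x
  ... | no 4≰x = contradiction (<4⇒Δ (≰⇒> 4≰x)) ¬Δx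

  A─B⇔ : ∀ {x} → (x ∈ A × x ∉ B) ⇔ (x ≡ e₀ ⊎ x ≡ e₁)
  A─B⇔ {x} = ⇔.trans (A─B x) (toℕ≡⇔≡point z<s ⊎-⇔ toℕ≡⇔≡point (s<s z<s))

  B─A⇔ : ∀ {x} → (x ∈ B × x ∉ A) ⇔ (x ≡ e₂ ⊎ x ≡ e₃)
  B─A⇔ {x} = ⇔.trans (B─A x) (toℕ≡⇔≡point (s<s (s<s z<s)) ⊎-⇔ toℕ≡⇔≡point (s<s (s<s (s<s z<s))))

  e₀≢e₁ : e₀ ≢ e₁
  e₀≢e₁ e₀≡e₁ = contradiction (point-injective z<s (s<s z<s) e₀≡e₁) λ ()

  e₂≢e₃ : e₂ ≢ e₃
  e₂≢e₃ e₂≡e₃ = contradiction (point-injective (s<s (s<s z<s)) (s<s (s<s (s<s z<s))) e₂≡e₃) λ ()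

  module AB = Configuration u A B e₀ e₁ e₂ e₃ A─B⇔ B─A⇔ e₀≢e₁ e₂≢e₃ (uniform A A∈𝓕) (uniform B B∈𝓕)
  module BA = Configuration u B A e₂ e₃ e₀ e₁ B─A⇔ A─B⇔ e₂≢e₃ e₀≢e₁ (uniform B B∈𝓕) (uniform A A∈𝓕)

  private
    e₀∉A∩B : e₀ ∉ A ∩ B
    e₀∉A∩B = proj₂ (AB.∈P─Q (inj₁ refl)) ∘ AB.C⊆Q

    e₁∉A∩B : e₁ ∉ A ∩ B
    e₁∉A∩B = proj₂ (AB.∈P─Q (inj₂ refl)) ∘ AB.C⊆Q

    1+s≤∣∁A∣ : suc s ≤ ∣ ∁ A ∣
    1+s≤∣∁A∣ = subst (suc s ≤_) (sym (trans (∣∁p∣≡n∸∣p∣ A) (cong (n ∸_) (uniform A A∈𝓕))))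
                     (m+n≤o⇒m≤o∸n (suc s) (≤-trans (≤-reflexive (reorder u s)) n-large))
      where
      reorder : ∀ u s → suc s + (2 + u) ≡ suc u + s + 2
      reorder = solve-∀

  size-lower-bound : 3 + (s + s) ≤ size 𝓕
  size-lower-bound =
    let (Y , ∣Y∣≡1+s , Y-unique , Y⊆∁A) = distinct-elements (suc s) (∁ A) 1+s≤∣∁A∣
        Y∩A≡∅ = All.map (λ y∈∁A → subst (_ ∉_) AB.P≡C∪⁅p₀⁆∪⁅p₁⁆ (x∈∁p⇒x∉p y∈∁A)) Y⊆∁A
        (𝓚 , 𝓚-admissible , 3+2s≤∣𝓚∣) = LowerBound.admissible-family u s (A ∩ B) e₀ e₁ AB.∣C∣≡u
                                            e₀∉A∩B e₁∉A∩B e₀≢e₁ 1≤s Y ∣Y∣≡1+s Y-unique Y∩A≡∅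
    in ≤-trans 3+2s≤∣𝓚∣ (maximum 𝓚 𝓚-admissible)

  meet : ∀ {P Q} → P ∈F 𝓕 → Q ∈F 𝓕 → u ≤ ∣ P ∩ Q ∣
  meet = members-meet uniform almost (≤-trans (m≤n+m (suc (s + s)) 2) size-lower-bound)

  D⇒∣S∩H∣≡u : ∀ {H} S → H ∈F 𝓕 → S ∈F Dfam 𝓕 H (suc u) → ∣ S ∩ H ∣ ≡ u
  D⇒∣S∩H∣≡u {H} S H∈𝓕 S∈D = let (S∈𝓕 , ∣S∩H∣<t) = ∈Dfam⁻ 𝓕 H S S∈D in ≤-antisym (≤-pred ∣S∩H∣<t) (meet S∈𝓕 H∈𝓕)

  part-iii : ∀ i → (∀ x → 4 ≤ toℕ x → x ∉ A ∪ B → ¬ (X A B i x ∈F 𝓕))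
                 ⊎ (∀ x → 4 ≤ toℕ x → x ∈ A ∩ B → ¬ (X A B i x ∈F 𝓕))
  part-iii i with Fin.any? (λ y → ¬? (y ∈? A ∪ B) ×-dec (𝓕 (X A B i y) Bool.≟ true))
  ... | no ∄y = inj₁ λ x _ x∉A∪B Xx∈𝓕 → ∄y (x , x∉A∪B , Xx∈𝓕)
  ... | yes (y , y∉A∪B , Xy∈𝓕) = inj₂ λ x _ x∈A∩B Xx∈𝓕 → <⇒≱ (begin-strict
    ∣ X A B i y ∩ X A B i x ∣   ≤⟨ p⊆q⇒∣p∣≤∣q∣ (X-outside∩X-inside⊆ A B i y∉A∪B x∈A∩B) ⟩
    ∣ (A ∩ B) - x ∣             <⟨ x∈p⇒∣p-x∣<∣p∣ x∈A∩B ⟩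
    ∣ A ∩ B ∣                   ≡⟨ AB.∣C∣≡u ⟩
    u                           ∎) (meet Xy∈𝓕 Xx∈𝓕)

  cross : Fin n → Fin n → Subset n
  cross i j = (A ∩ B) ∪ (⁅ i ⁆ ∪ ⁅ j ⁆)

  private
    cross-sets : List (Subset n)
    cross-sets = cross e₀ e₂ ∷ cross e₀ e₃ ∷ cross e₁ e₂ ∷ cross e₁ e₃ ∷ []

    cross∈cross-sets : ∀ {i j} → (i ≡ e₀ ⊎ i ≡ e₁) → (j ≡ e₂ ⊎ j ≡ e₃) → cross i j ∈ₗ cross-sets
    cross∈cross-sets (inj₁ refl) (inj₁ refl) = here refl
    cross∈cross-sets (inj₁ refl) (inj₂ refl) = there (here refl)
    cross∈cross-sets (inj₂ refl) (inj₁ refl) = there (there (here refl))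
    cross∈cross-sets (inj₂ refl) (inj₂ refl) = there (there (there (here refl)))

  -- Otherwise 𝓕 is covered by D(A), D(B), which share D, and three cross sets: |𝓕| ≤ 2s + 2.
  cross-sets-present : ∀ {D} → InD 𝓕 (suc u) A B D → ∀ {i j} → (i ≡ e₀ ⊎ i ≡ e₁) → (j ≡ e₂ ⊎ j ≡ e₃) → cross i j ∈F 𝓕
  cross-sets-present {D} (D∈D[A] , D∈D[B]) {i} {j} i-idx j-idx with 𝓕 (cross i j) in cross∈?𝓕
  ... | true = refl
  ... | false = contradiction (begin
    suc (3 + (s + s))              ≤⟨ s≤s size-lower-bound ⟩
    suc (size 𝓕)                   ≤⟨ s≤s (size-mono 𝓕⊆N∪D) ⟩
    suc (size (N ∪F (DA ∪F DB)))   ≤⟨ s≤s (size-∪F≤ N (DA ∪F DB)) ⟩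
    suc (size N + size (DA ∪F DB)) ≡⟨ +-suc (size N) _ ⟨
    size N + suc (size (DA ∪F DB)) ≤⟨ +-mono-≤ size-N≤3 (size-∪F-overlap DA DB D∈D[A] D∈D[B]) ⟩
    3 + (size DA + size DB)        ≤⟨ +-monoʳ-≤ 3 (+-mono-≤ (almost A A∈𝓕) (almost B B∈𝓕)) ⟩
    3 + (s + s)                    ∎) (<-irrefl refl)
    where
    DA DB N : Family n
    DA = Dfam 𝓕 A (suc u)
    DB = Dfam 𝓕 B (suc u)
    N S = 𝓕 S ∧ does (any? (S ≟ₛ_) cross-sets)

    size-N≤3 : size N ≤ 3
    size-N≤3 = ≤-pred (size<length N cross-sets (λ S S∈N → does≡true⇒ (any? (S ≟ₛ_) cross-sets) (∧-conicalʳ (𝓕 S) _ S∈N))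
                                    (cross∈cross-sets i-idx j-idx)
                                    (λ cross∈N → contradiction (trans (sym (∧-conicalˡ _ _ cross∈N)) cross∈?𝓕) λ ()))

    𝓕⊆N∪D : 𝓕 ⊆F (N ∪F (DA ∪F DB))
    𝓕⊆N∪D S S∈𝓕 with ∣ S ∩ A ∣ <? suc u | ∣ S ∩ B ∣ <? suc u
    ... | yes ∣S∩A∣<t | _ = ∈∪F⁺ N (DA ∪F DB) (inj₂ (∈∪F⁺ DA DB (inj₁ (∈Dfam⁺ 𝓕 A S∈𝓕 ∣S∩A∣<t))))
    ... | no _ | yes ∣S∩B∣<t = ∈∪F⁺ N (DA ∪F DB) (inj₂ (∈∪F⁺ DA DB (inj₂ (∈Dfam⁺ 𝓕 B S∈𝓕 ∣S∩B∣<t))))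
    ... | no ∣S∩A∣≮t | no ∣S∩B∣≮t =
      let (i' , j' , i'-idx , j'-idx , S≡) = AB.both-large S (uniform S S∈𝓕) (≮⇒≥ ∣S∩A∣≮t) (≮⇒≥ ∣S∩B∣≮t)
      in ∈∪F⁺ N (DA ∪F DB) (inj₁ (∧≡true S∈𝓕
           (dec-true (any? (S ≟ₛ_) cross-sets) (subst (_∈ₗ cross-sets) (sym S≡) (cross∈cross-sets i'-idx j'-idx)))))

  part-ii : ∀ D → InD 𝓕 (suc u) A B D →
      (Σ (Fin n) λ y → Σ (Fin n) λ y' → y ≢ y' × y ∉ A ∪ B × y' ∉ A ∪ B × D ≡ (A ∩ B) ∪ (⁅ y ⁆ ∪ ⁅ y' ⁆))
    ⊎ (Σ (Fin n) λ z → Σ (Fin n) λ z' → z ≢ z' × z ∈ A ∩ B × z' ∈ A ∩ B × D ≡ (A ∪ B) ─ (⁅ z ⁆ ∪ ⁅ z' ⁆))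
  part-ii D D∈𝒟@(D∈D[A] , D∈D[B]) =
    [ inj₁ , [ inj₂ , (λ (i , j , i-idx , j-idx , i∉D , j∉D , ∣D∩C∣<u) → contradiction (begin-strict
        ∣ D ∩ cross i j ∣  ≤⟨ p⊆q⇒∣p∣≤∣q∣ (D∩cross⊆D∩C i∉D j∉D) ⟩
        ∣ D ∩ (A ∩ B) ∣    <⟨ ∣D∩C∣<u ⟩
        u                  ∎) (≤⇒≯ (meet D∈𝓕 (cross-sets-present D∈𝒟 i-idx j-idx)))) ]′ ]′
    (AB.neither-large D (uniform D D∈𝓕) (D⇒∣S∩H∣≡u D A∈𝓕 D∈D[A]) (D⇒∣S∩H∣≡u D B∈𝓕 D∈D[B]))
    where
    D∈𝓕 : D ∈F 𝓕
    D∈𝓕 = proj₁ (∈Dfam⁻ 𝓕 A D {suc u} D∈D[A])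
    D∩cross⊆D∩C : ∀ {i j} → i ∉ D → j ∉ D → D ∩ cross i j ⊆ D ∩ (A ∩ B)
    D∩cross⊆D∩C {i} {j} i∉D j∉D k∈ with x∈p∩q⁻ D (cross i j) k∈
    ... | k∈D , k∈cross with x∈p∪q⁻ (A ∩ B) (⁅ i ⁆ ∪ ⁅ j ⁆) k∈cross
    ...   | inj₁ k∈C = x∈p∩q⁺ (k∈D , k∈C)
    ...   | inj₂ k∈ij with x∈⁅y⁆∪⁅z⁆⁻ k∈ij
    ...     | inj₁ refl = contradiction k∈D i∉D
    ...     | inj₂ refl = contradiction k∈D j∉D

  private
    A∈E : InE A B A
    A∈E = e₀ , e₁ , Δ⇒<4 (inj₁ (from A─B⇔ (inj₁ refl))) , Δ⇒<4 (inj₁ (from A─B⇔ (inj₂ refl))) , e₀≢e₁ ,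
          trans AB.P≡C∪⁅p₀⁆∪⁅p₁⁆ (sym (X-outside A B e₀ e₁∉A∩B))

    B∈E : InE A B B
    B∈E = e₂ , e₃ , Δ⇒<4 (inj₂ (from B─A⇔ (inj₁ refl))) , Δ⇒<4 (inj₂ e₃∈B─A) , e₂≢e₃ ,
          trans BA.P≡C∪⁅p₀⁆∪⁅p₁⁆ (trans (cong (_∪ (⁅ e₂ ⁆ ∪ ⁅ e₃ ⁆)) (∩-comm B A)) (sym (X-outside A B e₂ (Δ⇒∉A∩B (inj₂ e₃∈B─A)))))
      where
      e₃∈B─A = from B─A⇔ (inj₂ refl)

    both-large⇒E : ∀ S → ∣ S ∣ ≡ 2 + u → suc u ≤ ∣ S ∩ A ∣ → suc u ≤ ∣ S ∩ B ∣ → InE A B S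
    both-large⇒E S ∣S∣≡ u<∣S∩A∣ u<∣S∩B∣ =
      let (i , j , i-idx , j-idx , S≡) = AB.both-large S ∣S∣≡ u<∣S∩A∣ u<∣S∩B∣
          (i∈A , i∉B) = from A─B⇔ i-idx
          j∈B─A = from B─A⇔ j-idx
      in i , j , Δ⇒<4 (inj₁ (i∈A , i∉B)) , Δ⇒<4 (inj₂ j∈B─A) , (λ i≡j → proj₂ j∈B─A (subst (_∈ A) i≡j i∈A)) ,
         trans S≡ (sym (X-outside A B i (Δ⇒∉A∩B (inj₂ j∈B─A))))

    outside-shape⇒G : ∀ {S i y} → y ∉ A ∪ B → S ≡ (A ∩ B) ∪ (⁅ i ⁆ ∪ ⁅ y ⁆) → InG A B i S
    outside-shape⇒G {i = i} {y} y∉A∪B S≡ =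
      y , ¬Δ⇒4≤ (y∉A∪B ∘ Δ⇒∈A∪B) , trans S≡ (sym (X-outside A B i (y∉A∪B ∘ p⊆p∪q B ∘ p∩q⊆p A B)))

    inside-shape⇒G : ∀ {S j z} → z ∈ A ∩ B → S ≡ (A ∪ B) ─ (⁅ j ⁆ ∪ ⁅ z ⁆) → InG A B j S
    inside-shape⇒G {j = j} {z} z∈A∩B S≡ = z , ¬Δ⇒4≤ (λ Δz → Δ⇒∉A∩B Δz z∈A∩B) , trans S≡ (sym (X-inside A B j z∈A∩B))

    small-X-between : ∀ {i x} → toℕ i < 4 → toℕ x < 4 → A ∩ B ⊆ X A B i x × X A B i x ⊆ A ∪ B
    small-X-between {i} {x} i<4 x<4 = subst (λ T → A ∩ B ⊆ T × T ⊆ A ∪ B) (sym X≡) (p⊆p∪q _ , ⊆A∪B)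
      where
      X≡ = X-outside A B i (Δ⇒∉A∩B (<4⇒Δ x<4))
      ⊆A∪B : (A ∩ B) ∪ (⁅ i ⁆ ∪ ⁅ x ⁆) ⊆ A ∪ B
      ⊆A∪B k∈ with x∈p∪q⁻ (A ∩ B) _ k∈
      ... | inj₁ k∈A∩B = p⊆p∪q B (p∩q⊆p A B k∈A∩B)
      ... | inj₂ k∈ix with x∈⁅y⁆∪⁅z⁆⁻ k∈ix
      ...   | inj₁ refl = Δ⇒∈A∪B (<4⇒Δ i<4)
      ...   | inj₂ refl = Δ⇒∈A∪B (<4⇒Δ x<4)

    X-large≢X-small : ∀ {i x i' x'} → 4 ≤ toℕ x → toℕ i' < 4 → toℕ x' < 4 → X A B i x ≢ X A B i' x'
    X-large≢X-small {i} {x} {i'} {x'} 4≤x i'<4 x'<4 Xix≡Xi'x' = by-cases (x ∈? A ∩ B)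
      where
      Xi'x'≡ = X-outside A B i' (Δ⇒∉A∩B (<4⇒Δ x'<4))
      small≢x : ∀ {k} → toℕ k < 4 → x ≢ k
      small≢x k<4 refl = <⇒≱ k<4 4≤x
      by-cases : Dec (x ∈ A ∩ B) → ⊥
      by-cases (yes x∈A∩B) = proj₂ (x∈p─q⁻ (A ∪ B) (⁅ i ⁆ ∪ ⁅ x ⁆) x∈U─ix) (q⊆p∪q ⁅ i ⁆ ⁅ x ⁆ (x∈⁅x⁆ x))
        where
        x∈U─ix = subst (x ∈_) (trans (sym Xi'x'≡) (trans (sym Xix≡Xi'x') (X-inside A B i x∈A∩B))) (p⊆p∪q _ x∈A∩B)
      by-cases (no x∉A∩B)
        with x∈p∪q⁻ (A ∩ B) _ (subst (x ∈_) (trans (sym (X-outside A B i x∉A∩B)) (trans Xix≡Xi'x' Xi'x'≡))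
                                             (q⊆p∪q (A ∩ B) _ (q⊆p∪q ⁅ i ⁆ ⁅ x ⁆ (x∈⁅x⁆ x))))
      ... | inj₁ x∈A∩B = x∉A∩B x∈A∩B
      ... | inj₂ x∈i'x' = [ small≢x i'<4 , small≢x x'<4 ]′ (x∈⁅y⁆∪⁅z⁆⁻ x∈i'x')

  part-i⇒ : ∀ S → S ∈F 𝓕 → ¬ InE A B S →
            InD 𝓕 (suc u) A B S ⊎ Σ (Fin n) λ i → toℕ i < 4 × S ∈F 𝓕 × InG A B i S
  part-i⇒ S S∈𝓕 S∉E with ∣ S ∩ A ∣ <? suc u | ∣ S ∩ B ∣ <? suc u
  ... | yes ∣S∩A∣<t | yes ∣S∩B∣<t = inj₁ (∈Dfam⁺ 𝓕 A S∈𝓕 ∣S∩A∣<t , ∈Dfam⁺ 𝓕 B S∈𝓕 ∣S∩B∣<t)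
  ... | no ∣S∩A∣≮t | no ∣S∩B∣≮t = contradiction (both-large⇒E S (uniform S S∈𝓕) (≮⇒≥ ∣S∩A∣≮t) (≮⇒≥ ∣S∩B∣≮t)) S∉E
  ... | no ∣S∩A∣≮t | yes ∣S∩B∣<t = inj₂
    ([ (λ S≡A → contradiction (subst (InE A B) (sym S≡A) A∈E) S∉E)
     , [ (λ (i , y , i-idx , y∉A∪B , S≡) → i , Δ⇒<4 (inj₁ (from A─B⇔ i-idx)) , S∈𝓕 , outside-shape⇒G y∉A∪B S≡)
       , (λ (j , z , j-idx , z∈A∩B , S≡) → j , Δ⇒<4 (inj₂ (from B─A⇔ j-idx)) , S∈𝓕 , inside-shape⇒G z∈A∩B S≡)
       ]′ ]′
     (AB.one-large S (uniform S S∈𝓕) (≮⇒≥ ∣S∩A∣≮t) (≤-antisym (≤-pred ∣S∩B∣<t) (meet S∈𝓕 B∈𝓕))))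
  ... | yes ∣S∩A∣<t | no ∣S∩B∣≮t = inj₂
    ([ (λ S≡B → contradiction (subst (InE A B) (sym S≡B) B∈E) S∉E)
     , [ (λ (i , y , i-idx , y∉B∪A , S≡) → i , Δ⇒<4 (inj₂ (from B─A⇔ i-idx)) , S∈𝓕 ,
            outside-shape⇒G (y∉B∪A ∘ subst (y ∈_) (∪-comm A B)) (trans S≡ (cong (_∪ (⁅ i ⁆ ∪ ⁅ y ⁆)) (∩-comm B A))))
       , (λ (j , z , j-idx , z∈B∩A , S≡) → j , Δ⇒<4 (inj₁ (from A─B⇔ j-idx)) , S∈𝓕 ,
            inside-shape⇒G (subst (z ∈_) (∩-comm B A) z∈B∩A) (trans S≡ (cong (_─ (⁅ j ⁆ ∪ ⁅ z ⁆)) (∪-comm B A))))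
       ]′ ]′
     (BA.one-large S (uniform S S∈𝓕) (≮⇒≥ ∣S∩B∣≮t) (≤-antisym (≤-pred ∣S∩A∣<t) (meet S∈𝓕 A∈𝓕))))

  part-i⇐ : ∀ S → InD 𝓕 (suc u) A B S ⊎ (Σ (Fin n) λ i → toℕ i < 4 × S ∈F 𝓕 × InG A B i S) →
            S ∈F 𝓕 × ¬ InE A B S
  part-i⇐ S (inj₁ (S∈D[A] , S∈D[B])) = S∈𝓕 , λ (i , x , i<4 , x<4 , _ , S≡X) →
    let (C⊆X , X⊆U) = small-X-between i<4 x<4
    in contradiction (begin
      u + (2 + u)             ≡⟨ cong (u +_) (uniform S S∈𝓕) ⟨
      u + ∣ S ∣               ≡⟨ AB.C⊆S⊆U⇒∣S∩P∣+∣S∩Q∣≡u+∣S∣ (subst (A ∩ B ⊆_) (sym S≡X) C⊆X) (subst (_⊆ A ∪ B) (sym S≡X) X⊆U) ⟨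
      ∣ S ∩ A ∣ + ∣ S ∩ B ∣   ≤⟨ +-mono-≤ (≤-reflexive (D⇒∣S∩H∣≡u S A∈𝓕 S∈D[A])) (≤-reflexive (D⇒∣S∩H∣≡u S B∈𝓕 S∈D[B])) ⟩
      u + u                   ∎) (<⇒≱ (+-monoʳ-< u (≤-trans (n<1+n u) (n≤1+n (suc u)))))
    where
    S∈𝓕 : S ∈F 𝓕
    S∈𝓕 = proj₁ (∈Dfam⁻ 𝓕 A S {suc u} S∈D[A])
  part-i⇐ S (inj₂ (_ , _ , S∈𝓕 , _ , 4≤x , S≡X)) =
    S∈𝓕 , λ (_ , _ , i'<4 , x'<4 , _ , S≡X') → X-large≢X-small 4≤x i'<4 x'<4 (trans (sym S≡X) S≡X')

lemma6p2 : (n t s : ℕ) → 1 ≤ t → 1 ≤ s → t + s + 2 ≤ n →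
    (𝓕 : Family n) → Admissible s t 𝓕 →
    (∀ (𝓕' : Family n) → Admissible s t 𝓕' → size 𝓕' ≤ size 𝓕) →
    (A B : Subset n) → A ∈F 𝓕 → B ∈F 𝓕 →
    (∀ x → (x ∈ A × x ∉ B) ⇔ (toℕ x ≡ 0 ⊎ toℕ x ≡ 1)) →
    (∀ x → (x ∈ B × x ∉ A) ⇔ (toℕ x ≡ 2 ⊎ toℕ x ≡ 3)) →
    (∀ S → (S ∈F 𝓕 × ¬ InE A B S)
             ⇔ (InD 𝓕 t A B S ⊎ Σ (Fin n) λ i → toℕ i < 4 × S ∈F 𝓕 × InG A B i S))
    × (∀ D → InD 𝓕 t A B D →
         (Σ (Fin n) λ y → Σ (Fin n) λ y' → y ≢ y' × y ∉ A ∪ B × y' ∉ A ∪ B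
            × D ≡ (A ∩ B) ∪ (⁅ y ⁆ ∪ ⁅ y' ⁆))
         ⊎ (Σ (Fin n) λ z → Σ (Fin n) λ z' → z ≢ z' × z ∈ A ∩ B × z' ∈ A ∩ B
            × D ≡ (A ∪ B) ─ (⁅ z ⁆ ∪ ⁅ z' ⁆)))
    × (∀ (i : Fin n) → toℕ i < 4 →
         (∀ x → 4 ≤ toℕ x → x ∉ A ∪ B → ¬ (X A B i x ∈F 𝓕))
         ⊎ (∀ x → 4 ≤ toℕ x → x ∈ A ∩ B → ¬ (X A B i x ∈F 𝓕)))
lemma6p2 _ zero _ ()
lemma6p2 n (suc u) s _ 1≤s n-large 𝓕 admissible maximum A B A∈𝓕 B∈𝓕 A─B B─A =
  (λ S → mk⇔ (λ (S∈𝓕 , S∉E) → part-i⇒ S S∈𝓕 S∉E) (part-i⇐ S)) , part-ii , λ i _ → part-iii i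
  where open Maximal 1≤s n-large admissible maximum A∈𝓕 B∈𝓕 A─B B─A
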